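{- Let $T$, $B$, $X$ be the unique formal power series in $t$ with $T=1+tT^3$, $B=tT^2$, and $X=B(1+X+X^2)$ with $X=0$ at $t=0$; let $T(u)$ be the unique formal power series in $t$ (coefficients in $\mathbb{Q}[u]$) with $T(u)=1+tu\,T(u)^2\,T$. For every integer $j\geq -2$ set \[ H_j(u)=(1-X^{j+1})\,X\,T(u)-(1+X)(1-X^{j+2}). \] For every integer $j\geq -1$, let $T_j(u)=\sum_{\tau} t^{|\tau|}u^{c(\tau)}$, the sum being over all $j$-positive trees $\tau$, where $|\tau|$ is the number of nodes and $c(\tau)$ the number of nodes in the core of $\tau$ (the empty tree contributes $1$). Then for every $j\geq -1$, \[ T_j(u)=T(u)\,\frac{H_j(u)}{H_{j-1}(u)}\,\frac{1-X^{j+2}}{1-X^{j+3}}. \]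
   Context: A ternary tree is either empty or consists of a root and three ternary trees (left, middle and right subtrees of the root). For an integer $j$, embed a ternary tree on the integers by giving the root abscissa $j$ and, for a node of abscissa $i$, giving its left child abscissa $i+1$, its middle child abscissa $i$ and its right child abscissa $i-1$. A $j$-positive tree is a ternary tree all of whose nodes have non-negative abscissa in this embedding (so for $j=-1$ only the empty tree qualifies). The core of a nonempty ternary tree is the largest subtree containing the root and using only left and middle edges (the nodes reachable from the root by left and middle child steps only); the empty tree has empty core. -}

module Defs where

open import Data.Nat as ℕ using (ℕ; zero; suc)
open import Data.Integer as ℤ using (ℤ; +_)
open import Data.Rational as ℚ using (ℚ; 0ℚ; 1ℚ)
open import Data.Bool using (Bool; true; false; _∧_; T?)
open import Data.List using (List; []; _∷_; concatMap; filter; length; map; foldr; upTo)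
open import Relation.Binary.PropositionalEquality using (_≡_)
open import Relation.Nullary.Decidable using (⌊_⌋)

-- Formal power series in t with coefficients in ℚ[u], represented as
-- bivariate series: F n k is the coefficient of t^n u^k.

FPS : Set
FPS = ℕ → ℕ → ℚ

infix 4 _≈_
_≈_ : FPS → FPS → Set
F ≈ G = ∀ n k → F n k ≡ G n k

const : ℚ → FPS
const c zero zero = c
const c _ _ = 0ℚ

𝟘 𝟙 : FPS
𝟘 = const 0ℚ
𝟙 = const 1ℚ

tS : FPS
tS (suc zero) zero = 1ℚ
tS _ _ = 0ℚ

uS : FPS
uS zero (suc zero) = 1ℚ
uS _ _ = 0ℚ

infixl 6 _⊕_ _⊖_
infixl 7 _⊗_
infixr 8 _^S_

_⊕_ : FPS → FPS → FPS
(F ⊕ G) n k = F n k ℚ.+ G n k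

_⊖_ : FPS → FPS → FPS
(F ⊖ G) n k = F n k ℚ.- G n k

Σ≤ : ℕ → (ℕ → ℚ) → ℚ
Σ≤ n f = foldr (λ i acc → f i ℚ.+ acc) 0ℚ (upTo (suc n))

_⊗_ : FPS → FPS → FPS
(F ⊗ G) n k = Σ≤ n (λ a → Σ≤ k (λ b → F a b ℚ.* G (n ℕ.∸ a) (k ℕ.∸ b)))

_^S_ : FPS → ℕ → FPS
F ^S zero = 𝟙
F ^S suc m = F ⊗ (F ^S m)

data Tree : Set where
  leaf : Tree                        -- the empty tree
  node : Tree → Tree → Tree → Tree

size : Tree → ℕ
size leaf = 0
size (node l m r) = suc (size l ℕ.+ size m ℕ.+ size r)

-- number of nodes of the core (reachable from the root by left/middle steps)
coreSize : Tree → ℕ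
coreSize leaf = 0
coreSize (node l m r) = suc (coreSize l ℕ.+ coreSize m)

-- isPositive j τ : every node of τ has non-negative abscissa when the root
-- has abscissa j (left child i+1, middle child i, right child i-1).
isPositive : ℤ → Tree → Bool
isPositive j leaf = true
isPositive j (node l m r) =
  (+ 0 ℤ.≤ᵇ j) ∧ isPositive (j ℤ.+ + 1) l ∧ isPositive j m ∧ isPositive (j ℤ.- + 1) r

-- all ternary trees of depth ≤ d (each exactly once)
treesDepth : ℕ → List Tree
treesDepth zero = leaf ∷ []
treesDepth (suc d) =
  leaf ∷ concatMap (λ l → concatMap (λ m → map (λ r → node l m r) (treesDepth d))
                                     (treesDepth d))
                   (treesDepth d)

-- all ternary trees with exactly n nodes (such a tree has depth ≤ n)
treesOfSize : ℕ → List Tree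
treesOfSize n = filter (λ τ → size τ ℕ.≟ n) (treesDepth n)

Tgf : ℤ → FPS
Tgf j n k = (+ length (filter
  (λ τ → T? (isPositive j τ ∧ ⌊ coreSize τ ℕ.≟ k ⌋))
  (treesOfSize n))) ℚ./ 1

-- X^(e) for an integer exponent e ≥ 0 (used only with e ≥ 0)
_^ℤ_ : FPS → ℤ → FPS
F ^ℤ e = F ^S ℤ.∣ e ∣

-- H_j(u) = (1 - X^{j+1}) X T(u) - (1+X)(1 - X^{j+2}),  j ≥ -2,
-- written as (X - X^{j+2}) T(u) - (1+X)(1 - X^{j+2}) so that no
-- negative power of X appears when j = -2.
Hj : (X Tu : FPS) → ℤ → FPS
Hj X Tu j = (X ⊖ X ^ℤ (j ℤ.+ + 2)) ⊗ Tu ⊖ (𝟙 ⊕ X) ⊗ (𝟙 ⊖ X ^ℤ (j ℤ.+ + 2))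

-- Splitting a tree at its root, and noting that the right subtree of a node lies outside the
-- core, the series T_j(u) and S_j = T_j(1) of j-positive trees satisfy, for j ≥ 0,
--   T_j(u) = 1 + t u T_(j+1)(u) T_j(u) S_(j-1),   S_j = 1 + t S_(j+1) S_j S_(j-1),
-- with T_(-1)(u) = S_(-1) = 1.  The unknowns enter the right-hand sides only multiplied by t, so
-- this system determines its solution coefficient by coefficient (the counting series are the
-- limits of the sums over trees of bounded depth).  It therefore suffices that the closed forms
--   S_j = T (1 - X^(j+2)) (1 - X^(j+5)) / ((1 - X^(j+3)) (1 - X^(j+4))),
--   T_j(u) = T(u) H_j (1 - X^(j+2)) / (H_(j-1) (1 - X^(j+3)))
-- satisfy it; their denominators have constant term ±1.  With denominators cleared and X^(j+1)
-- as a new variable these become polynomial identities, which follow from the equations defining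
-- T and T(u) and from T (1 + X²) = 1 + X + X², a consequence of the equations defining X.

module Submission where

open import Algebra using (CommutativeRing; RawRing; Congruent₁; Congruent₂)
open import Relation.Binary using (Rel; Reflexive)

module PowerSeries {c ℓ} (R : CommutativeRing c ℓ) where
  open import Algebra.Structures using (IsCommutativeRing)
  open import Data.Nat using (ℕ; zero; suc; z≤n; s≤s; _∸_; _<_) renaming (_≤_ to _≤ℕ_; _+_ to _+ℕ_)
  open import Data.Nat.Properties
    using ( m≤n⇒m≤1+n; ≤-refl; ≤-<-trans; <-≤-trans; m≤n+m; m∸n+n≡m; m∸n≤m; m<1+n⇒m<n∨m≡n
          ; +-∸-assoc; m+[n∸m]≡n; m∸[m∸n]≡n; m+n∸m≡n; ∸-+-assoc; +-suc; n∸n≡0)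
    renaming (+-identityʳ to +ℕ-identityʳ)
  open import Data.Product using (_,_)
  open import Data.Sum using (inj₁; inj₂)
  open import Relation.Binary.PropositionalEquality as ≡ using (_≡_)

  open CommutativeRing R
  open import Algebra.Properties.CommutativeSemigroup +-commutativeSemigroup using (interchange)
  open import Algebra.Properties.Group +-group using (∙-cancelʳ)
  open import Relation.Binary.Reasoning.Setoid setoid

  ∑ : ℕ → (ℕ → Carrier) → Carrier
  ∑ zero f = f 0
  ∑ (suc n) f = ∑ n f + f (suc n)

  ∑-cong-≤ : ∀ n {f g : ℕ → Carrier} → (∀ i → i ≤ℕ n → f i ≈ g i) → ∑ n f ≈ ∑ n g
  ∑-cong-≤ zero f≈g = f≈g 0 z≤n
  ∑-cong-≤ (suc n) f≈g =
    +-cong (∑-cong-≤ n (λ i i≤n → f≈g i (m≤n⇒m≤1+n i≤n))) (f≈g (suc n) ≤-refl)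

  ∑-cong : ∀ n {f g : ℕ → Carrier} → (∀ i → f i ≈ g i) → ∑ n f ≈ ∑ n g
  ∑-cong n f≈g = ∑-cong-≤ n (λ i _ → f≈g i)

  ∑-zero : ∀ n (f : ℕ → Carrier) → (∀ i → i ≤ℕ n → f i ≈ 0#) → ∑ n f ≈ 0#
  ∑-zero zero f f≈0 = f≈0 0 z≤n
  ∑-zero (suc n) f f≈0 =
    trans (+-cong (∑-zero n f (λ i i≤n → f≈0 i (m≤n⇒m≤1+n i≤n))) (f≈0 (suc n) ≤-refl)) (+-identityˡ 0#)

  ∑-+ : ∀ n (f g : ℕ → Carrier) → ∑ n (λ i → f i + g i) ≈ ∑ n f + ∑ n g
  ∑-+ zero f g = refl
  ∑-+ (suc n) f g = trans (+-congʳ (∑-+ n f g)) (interchange _ _ _ _)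

  *-distribˡ-∑ : ∀ n a (f : ℕ → Carrier) → a * ∑ n f ≈ ∑ n (λ i → a * f i)
  *-distribˡ-∑ zero a f = refl
  *-distribˡ-∑ (suc n) a f = trans (distribˡ a _ _) (+-congʳ (*-distribˡ-∑ n a f))

  *-distribʳ-∑ : ∀ n a (f : ℕ → Carrier) → ∑ n f * a ≈ ∑ n (λ i → f i * a)
  *-distribʳ-∑ zero a f = refl
  *-distribʳ-∑ (suc n) a f = trans (distribʳ a _ _) (+-congʳ (*-distribʳ-∑ n a f))

  ∑-unfoldˡ : ∀ n (f : ℕ → Carrier) → ∑ (suc n) f ≈ f 0 + ∑ n (λ i → f (suc i))
  ∑-unfoldˡ zero f = refl
  ∑-unfoldˡ (suc n) f = trans (+-congʳ (∑-unfoldˡ n f)) (+-assoc _ _ _)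

  ∑-reverse : ∀ n (f : ℕ → Carrier) → ∑ n f ≈ ∑ n (λ i → f (n ∸ i))
  ∑-reverse zero f = refl
  ∑-reverse (suc n) f = begin
    ∑ n f + f (suc n)                   ≈⟨ +-congʳ (∑-reverse n f) ⟩
    ∑ n (λ i → f (n ∸ i)) + f (suc n)   ≈⟨ +-comm _ _ ⟩
    f (suc n) + ∑ n (λ i → f (n ∸ i))   ≈⟨ ∑-unfoldˡ n (λ i → f (suc n ∸ i)) ⟨
    ∑ (suc n) (λ i → f (suc n ∸ i))     ∎

  ≡⇒≈ : ∀ {x y} → x ≡ y → x ≈ y
  ≡⇒≈ ≡.refl = refl

  ∑-triangle : ∀ n (F : ℕ → ℕ → Carrier) →
    ∑ n (λ a → ∑ a (λ b → F b a)) ≈ ∑ n (λ b → ∑ (n ∸ b) (λ d → F b (b +ℕ d)))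
  ∑-triangle zero F = refl
  ∑-triangle (suc n) F = begin
    ∑ n (λ a → ∑ a (λ b → F b a)) + ∑ (suc n) (λ b → F b (suc n))
      ≈⟨ +-congʳ (∑-triangle n F) ⟩
    rows n + (∑ n (λ b → F b (suc n)) + F (suc n) (suc n))
      ≈⟨ +-assoc _ _ _ ⟨
    (rows n + ∑ n (λ b → F b (suc n))) + F (suc n) (suc n)
      ≈⟨ +-cong (∑-+ n _ _) (≡⇒≈ (≡.cong (F (suc n)) (+ℕ-identityʳ (suc n)))) ⟨
    ∑ n (λ b → ∑ (n ∸ b) (λ d → F b (b +ℕ d)) + F b (suc n)) + F (suc n) (suc n +ℕ 0)
      ≈⟨ +-congʳ (∑-cong-≤ n extend-row) ⟩
    ∑ n (λ b → ∑ (suc n ∸ b) (λ d → F b (b +ℕ d))) + F (suc n) (suc n +ℕ 0)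
      ≈⟨ +-congˡ (≡⇒≈ (≡.cong (λ m → ∑ m (λ d → F (suc n) (suc n +ℕ d))) (n∸n≡0 n))) ⟨
    ∑ n (λ b → ∑ (suc n ∸ b) (λ d → F b (b +ℕ d))) + ∑ (n ∸ n) (λ d → F (suc n) (suc n +ℕ d)) ∎
    where
    rows : ℕ → Carrier
    rows m = ∑ m (λ b → ∑ (m ∸ b) (λ d → F b (b +ℕ d)))
    extend-row : ∀ b → b ≤ℕ n →
      ∑ (n ∸ b) (λ d → F b (b +ℕ d)) + F b (suc n) ≈ ∑ (suc n ∸ b) (λ d → F b (b +ℕ d))
    extend-row b b≤n rewrite +-∸-assoc 1 b≤n = +-congˡ (≡⇒≈ (≡.cong (F b)
      (≡.sym (≡.trans (+-suc b (n ∸ b)) (≡.cong suc (m+[n∸m]≡n b≤n))))))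

  Series : Set c
  Series = ℕ → Carrier

  infix 4 _≋_
  infixl 6 _⊹_
  infixl 7 _⋆_

  _≋_ : Series → Series → Set ℓ
  f ≋ g = ∀ n → f n ≈ g n

  _⊹_ : Series → Series → Series
  (f ⊹ g) n = f n + g n

  ⊝_ : Series → Series
  (⊝ f) n = - f n

  constant : Carrier → Series
  constant x zero = x
  constant x (suc n) = 0#

  _⋆_ : Series → Series → Series
  (f ⋆ g) n = ∑ n (λ a → f a * g (n ∸ a))

  ⋆-cong : ∀ {f f′ g g′} → f ≋ f′ → g ≋ g′ → f ⋆ g ≋ f′ ⋆ g′
  ⋆-cong f≋f′ g≋g′ n = ∑-cong n (λ a → *-cong (f≋f′ a) (g≋g′ (n ∸ a)))

  ⋆-comm : ∀ f g → f ⋆ g ≋ g ⋆ f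
  ⋆-comm f g n = trans (∑-reverse n _) (∑-cong-≤ n (λ a a≤n →
    trans (*-comm _ _) (*-congʳ (≡⇒≈ (≡.cong g (m∸[m∸n]≡n a≤n))))))

  ⋆-assoc : ∀ f g h → (f ⋆ g) ⋆ h ≋ f ⋆ (g ⋆ h)
  ⋆-assoc f g h n = begin
    ∑ n (λ a → ∑ a (λ b → f b * g (a ∸ b)) * h (n ∸ a))
      ≈⟨ ∑-cong n (λ a → *-distribʳ-∑ a _ _) ⟩
    ∑ n (λ a → ∑ a (λ b → (f b * g (a ∸ b)) * h (n ∸ a)))
      ≈⟨ ∑-triangle n (λ b a → (f b * g (a ∸ b)) * h (n ∸ a)) ⟩
    ∑ n (λ b → ∑ (n ∸ b) (λ d → (f b * g (b +ℕ d ∸ b)) * h (n ∸ (b +ℕ d))))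
      ≈⟨ ∑-cong n (λ b → ∑-cong (n ∸ b) (λ d → trans (*-assoc _ _ _) (*-congˡ (*-cong
           (≡⇒≈ (≡.cong g (m+n∸m≡n b d))) (≡⇒≈ (≡.cong h (≡.sym (∸-+-assoc n b d)))))))) ⟩
    ∑ n (λ b → ∑ (n ∸ b) (λ d → f b * (g d * h (n ∸ b ∸ d))))
      ≈⟨ ∑-cong n (λ b → *-distribˡ-∑ (n ∸ b) _ _) ⟨
    ∑ n (λ b → f b * ∑ (n ∸ b) (λ d → g d * h (n ∸ b ∸ d))) ∎

  constant-⋆ : ∀ x g → constant x ⋆ g ≋ (λ n → x * g n)
  constant-⋆ x g zero = refl
  constant-⋆ x g (suc n) = begin
    ∑ (suc n) (λ a → constant x a * g (suc n ∸ a))  ≈⟨ ∑-unfoldˡ n _ ⟩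
    x * g (suc n) + ∑ n (λ a → 0# * g (n ∸ a))     ≈⟨ +-congˡ (∑-zero n _ (λ i _ → zeroˡ _)) ⟩
    x * g (suc n) + 0#                             ≈⟨ +-identityʳ _ ⟩
    x * g (suc n)                                  ∎

  ⋆-identityˡ : ∀ f → constant 1# ⋆ f ≋ f
  ⋆-identityˡ f n = trans (constant-⋆ 1# f n) (*-identityˡ (f n))

  ⋆-distribˡ : ∀ f g h → f ⋆ (g ⊹ h) ≋ f ⋆ g ⊹ f ⋆ h
  ⋆-distribˡ f g h n = trans (∑-cong n (λ a → distribˡ _ _ _)) (∑-+ n _ _)

  ⊹-⋆-isCommutativeRing : IsCommutativeRing _≋_ _⊹_ _⋆_ ⊝_ (constant 0#) (constant 1#)
  ⊹-⋆-isCommutativeRing = record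
    { isRing = record
      { +-isAbelianGroup = record
        { isGroup = record
          { isMonoid = record
            { isSemigroup = record
              { isMagma = record
                { isEquivalence = record
                  { refl = λ n → refl ; sym = λ p n → sym (p n) ; trans = λ p q n → trans (p n) (q n) }
                ; ∙-cong = λ p q n → +-cong (p n) (q n) }
              ; assoc = λ f g h n → +-assoc _ _ _ }
            ; identity = zero-identityˡ , zero-identityʳ }
          ; inverse = inverseˡ , inverseʳ
          ; ⁻¹-cong = λ p n → -‿cong (p n) }
        ; comm = λ f g n → +-comm _ _ }
      ; *-cong = ⋆-cong
      ; *-assoc = ⋆-assoc
      ; *-identity = ⋆-identityˡ , (λ f n → trans (⋆-comm f _ n) (⋆-identityˡ f n))
      ; distrib = ⋆-distribˡ , λ f g h n →
          trans (⋆-comm (g ⊹ h) f n)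
            (trans (⋆-distribˡ f g h n) (+-cong (⋆-comm f g n) (⋆-comm f h n))) }
    ; *-comm = ⋆-comm }
    where
    zero-identityˡ : ∀ f → constant 0# ⊹ f ≋ f
    zero-identityˡ f zero = +-identityˡ _
    zero-identityˡ f (suc n) = +-identityˡ _
    zero-identityʳ : ∀ f → f ⊹ constant 0# ≋ f
    zero-identityʳ f zero = +-identityʳ _
    zero-identityʳ f (suc n) = +-identityʳ _
    inverseˡ : ∀ f → ⊝ f ⊹ f ≋ constant 0#
    inverseˡ f zero = -‿inverseˡ _
    inverseˡ f (suc n) = -‿inverseˡ _
    inverseʳ : ∀ f → f ⊹ ⊝ f ≋ constant 0#
    inverseʳ f zero = -‿inverseʳ _
    inverseʳ f (suc n) = -‿inverseʳ _

  ⊹-⋆-commutativeRing : CommutativeRing c ℓ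
  ⊹-⋆-commutativeRing = record { isCommutativeRing = ⊹-⋆-isCommutativeRing }

  infix 4 _≋[_]_
  _≋[_]_ : Series → ℕ → Series → Set ℓ
  f ≋[ n ] g = ∀ m → m < n → f m ≈ g m

  ≋⇒≋[] : ∀ {n f g} → f ≋ g → f ≋[ n ] g
  ≋⇒≋[] f≋g m _ = f≋g m

  ≋[]⇒≋ : ∀ {f g} → (∀ n → f ≋[ n ] g) → f ≋ g
  ≋[]⇒≋ f≋g m = f≋g (suc m) m ≤-refl

  ≋[]-refl : ∀ {n f} → f ≋[ n ] f
  ≋[]-refl m _ = refl

  ≋[]-sym : ∀ {n f g} → f ≋[ n ] g → g ≋[ n ] f
  ≋[]-sym f≋g m m<n = sym (f≋g m m<n)

  ≋[]-trans : ∀ {n f g h} → f ≋[ n ] g → g ≋[ n ] h → f ≋[ n ] h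
  ≋[]-trans f≋g g≋h m m<n = trans (f≋g m m<n) (g≋h m m<n)

  ≋[]-weaken-≤ : ∀ {m n f g} → m ≤ℕ n → f ≋[ n ] g → f ≋[ m ] g
  ≋[]-weaken-≤ m≤n f≋g k k<m = f≋g k (<-≤-trans k<m m≤n)

  ≋[]-weaken : ∀ {n f g} → f ≋[ suc n ] g → f ≋[ n ] g
  ≋[]-weaken {n} = ≋[]-weaken-≤ (m≤n⇒m≤1+n (≤-refl {n}))

  ⊹-cong-≋[] : ∀ {n f f′ g g′} → f ≋[ n ] f′ → g ≋[ n ] g′ → f ⊹ g ≋[ n ] f′ ⊹ g′
  ⊹-cong-≋[] f≋f′ g≋g′ m m<n = +-cong (f≋f′ m m<n) (g≋g′ m m<n)

  ⊝-cong-≋[] : ∀ {n f f′} → f ≋[ n ] f′ → ⊝ f ≋[ n ] ⊝ f′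
  ⊝-cong-≋[] f≋f′ m m<n = -‿cong (f≋f′ m m<n)

  ⋆-cong-≋[] : ∀ {n f f′ g g′} → f ≋[ n ] f′ → g ≋[ n ] g′ → f ⋆ g ≋[ n ] f′ ⋆ g′
  ⋆-cong-≋[] f≋f′ g≋g′ m m<n = ∑-cong-≤ m (λ a a≤m →
    *-cong (f≋f′ a (≤-<-trans a≤m m<n)) (g≋g′ (m ∸ a) (≤-<-trans (m∸n≤m m a) m<n)))

  ⋆-raise-≋[] : ∀ {n f g g′} → f 0 ≈ 0# → g ≋[ n ] g′ → f ⋆ g ≋[ suc n ] f ⋆ g′
  ⋆-raise-≋[] {n} {f} {g} {g′} f₀≈0 g≋g′ m m<1+n = ∑-cong-≤ m (term m m<1+n)
    where
    term : ∀ m → m < suc n → ∀ a → a ≤ℕ m → f a * g (m ∸ a) ≈ f a * g′ (m ∸ a)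
    term m _ zero _ = trans (*-congʳ f₀≈0) (trans (zeroˡ _) (sym (trans (*-congʳ f₀≈0) (zeroˡ _))))
    term (suc m) (s≤s m<n) (suc a) _ = *-congˡ (g≋g′ (m ∸ a) (≤-<-trans (m∸n≤m m a) m<n))

  private
    tail : Series → Series → ℕ → Carrier
    tail f g zero = 0#
    tail f g (suc n) = ∑ n (λ a → f (suc a) * g (n ∸ a))

    ⋆-split : ∀ f g n → (f ⋆ g) n ≈ f 0 * g n + tail f g n
    ⋆-split f g zero = sym (+-identityʳ _)
    ⋆-split f g (suc n) = ∑-unfoldˡ n _

    tail-cong : ∀ {n} f {g g′} → g ≋[ n ] g′ → tail f g n ≈ tail f g′ n
    tail-cong {zero} f g≋g′ = refl
    tail-cong {suc n} f g≋g′ = ∑-cong n (λ a → *-congˡ (g≋g′ (n ∸ a) (s≤s (m∸n≤m n a))))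

  ⋆-cancelˡ-≋[] : ∀ {n f g g′} → (∀ x y → f 0 * x ≈ f 0 * y → x ≈ y) →
    f ⋆ g ≋[ n ] f ⋆ g′ → g ≋[ n ] g′
  ⋆-cancelˡ-≋[] {zero} cancel fg≋fg′ m ()
  ⋆-cancelˡ-≋[] {suc n} {f} {g} {g′} cancel fg≋fg′ m m<1+n with m<1+n⇒m<n∨m≡n m<1+n
  ... | inj₁ m<n = ⋆-cancelˡ-≋[] {n} {f} {g} {g′} cancel (≋[]-weaken fg≋fg′) m m<n
  ... | inj₂ ≡.refl = cancel (g m) (g′ m) (∙-cancelʳ (tail f g m) _ _ (begin
    f 0 * g m + tail f g m    ≈⟨ ⋆-split f g m ⟨
    (f ⋆ g) m                 ≈⟨ fg≋fg′ m m<1+n ⟩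
    (f ⋆ g′) m                ≈⟨ ⋆-split f g′ m ⟩
    f 0 * g′ m + tail f g′ m  ≈⟨ +-congˡ (tail-cong f g≋g′) ⟨
    f 0 * g′ m + tail f g m   ∎))
    where
    g≋g′ : g ≋[ m ] g′
    g≋g′ = ⋆-cancelˡ-≋[] {m} {f} {g} {g′} cancel (≋[]-weaken fg≋fg′)

  var : Series
  var (suc zero) = 1#
  var _ = 0#

  var-⋆-zero : ∀ f → (var ⋆ f) 0 ≈ 0#
  var-⋆-zero f = zeroˡ (f 0)

  var-⋆-suc : ∀ f n → (var ⋆ f) (suc n) ≈ f n
  var-⋆-suc f n = begin
    ∑ (suc n) (λ a → var a * f (suc n ∸ a))      ≈⟨ ∑-unfoldˡ n _ ⟩
    0# * f (suc n) + ∑ n (λ a → var (suc a) * f (n ∸ a))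
      ≈⟨ trans (+-congʳ (zeroˡ _)) (+-identityˡ _) ⟩
    ∑ n (λ a → var (suc a) * f (n ∸ a))          ≈⟨ picks-first n ⟩
    f n                                         ∎
    where
    picks-first : ∀ n → ∑ n (λ a → var (suc a) * f (n ∸ a)) ≈ f n
    picks-first zero = *-identityˡ (f 0)
    picks-first (suc n) = begin
      ∑ (suc n) (λ a → var (suc a) * f (suc n ∸ a))
        ≈⟨ ∑-unfoldˡ n _ ⟩
      1# * f (suc n) + ∑ n (λ a → 0# * f (n ∸ a))
        ≈⟨ +-cong (*-identityˡ _) (∑-zero n _ (λ a _ → zeroˡ _)) ⟩
      f (suc n) + 0#
        ≈⟨ +-identityʳ _ ⟩
      f (suc n) ∎

  -- The iterates of a map raising the order of agreement stabilise coefficientwise, coefficient n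
  -- from the n-th iterate on, so their diagonal is a fixed point.
  module Iteration {a} {I : Set a} (Φ : (I → Series) → I → Series)
    (Φ-contracting : ∀ n {f g} → (∀ i → f i ≋[ n ] g i) → ∀ i → Φ f i ≋[ suc n ] Φ g i)
    (f : ℕ → I → Series) (seed : I → Series)
    (f-zero : ∀ i → f 0 i ≋ Φ seed i) (f-suc : ∀ d i → f (suc d) i ≋ Φ (f d) i)
    where

    consecutive : ∀ d i → f d i ≋[ suc d ] f (suc d) i
    consecutive zero i = ≋[]-trans (≋⇒≋[] (f-zero i))
      (≋[]-trans (Φ-contracting 0 (λ _ _ ()) i) (≋⇒≋[] (λ m → sym (f-suc 0 i m))))
    consecutive (suc d) i = ≋[]-trans (≋⇒≋[] (f-suc d i))
      (≋[]-trans (Φ-contracting (suc d) (consecutive d) i) (≋⇒≋[] (λ m → sym (f-suc (suc d) i m))))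

    stable : ∀ e d i → f d i ≋[ suc d ] f (e +ℕ d) i
    stable zero d i = ≋[]-refl
    stable (suc e) d i =
      ≋[]-trans (stable e d i) (≋[]-weaken-≤ (s≤s (m≤n+m d e)) (consecutive (e +ℕ d) i))

    limit : I → Series
    limit i n = f n i n

    limit-agrees : ∀ d i → f d i ≋[ suc d ] limit i
    limit-agrees d i m (s≤s m≤d) = sym (trans (stable (d ∸ m) m i m ≤-refl)
      (≡⇒≈ (≡.cong (λ e → f e i m) (m∸n+n≡m m≤d))))

    limit-fixed : ∀ i → limit i ≋ Φ limit i
    limit-fixed i = ≋[]⇒≋ agree
      where
      agree : ∀ n → limit i ≋[ n ] Φ limit i
      agree zero m ()
      agree (suc n) = ≋[]-trans (≋[]-weaken (≋[]-sym (limit-agrees (suc n) i)))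
        (≋[]-trans (≋⇒≋[] (f-suc n i)) (Φ-contracting n (λ j → ≋[]-weaken (limit-agrees n j)) i))

module SeriesRing where
  open import Algebra.Morphism.Structures using (IsRingMonomorphism)
  import Algebra.Morphism.RingMonomorphism as RingMonomorphism
  open import Data.Nat using (ℕ; zero; suc; _∸_; s≤s; z≤n)
  open import Data.Product using (Σ-syntax; _×_; _,_)
  open import Data.List using (foldr; applyUpTo)
  open import Data.Rational as ℚ using (ℚ; 0ℚ; 1ℚ)
  import Data.Rational.Properties as ℚ
  open import Function using (_∘_; id)
  open import Relation.Binary.PropositionalEquality as ≡ using (_≡_; refl; cong)

  open import Defs

  module ℚ[[u]] = PowerSeries ℚ.+-*-commutativeRing
  module ℚ[[u]][[t]] = PowerSeries ℚ[[u]].⊹-⋆-commutativeRing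
  open ℚ[[u]][[t]] public
    using (_≋[_]_; ≋⇒≋[]; ≋[]⇒≋; ≋[]-refl; ≋[]-trans)
    renaming (⊹-cong-≋[] to ⊕-cong-≋[]; ⊝-cong-≋[] to neg-cong-≋[])

  foldr-applyUpTo : ∀ n (f : ℕ → ℚ) (g : ℕ → ℕ) →
    foldr (λ i acc → f i ℚ.+ acc) 0ℚ (applyUpTo g (suc n)) ≡ ℚ[[u]].∑ n (f ∘ g)
  foldr-applyUpTo zero f g = ℚ.+-identityʳ (f (g 0))
  foldr-applyUpTo (suc n) f g =
    ≡.trans (cong (f (g 0) ℚ.+_) (foldr-applyUpTo n f (g ∘ suc))) (≡.sym (ℚ[[u]].∑-unfoldˡ n (f ∘ g)))

  Σ≤≡∑ : ∀ n f → Σ≤ n f ≡ ℚ[[u]].∑ n f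
  Σ≤≡∑ n f = foldr-applyUpTo n f id

  coefficient-⊗ : ∀ F G n k →
    (F ⊗ G) n k ≡ ℚ[[u]].∑ n (λ a → ℚ[[u]].∑ k (λ b → F a b ℚ.* G (n ∸ a) (k ∸ b)))
  coefficient-⊗ F G n k = ≡.trans (Σ≤≡∑ n _) (ℚ[[u]].∑-cong n (λ a → Σ≤≡∑ k _))

  ∑-coefficient : ∀ n (H : ℕ → ℚ[[u]].Series) k → ℚ[[u]][[t]].∑ n H k ≡ ℚ[[u]].∑ n (λ a → H a k)
  ∑-coefficient zero H k = refl
  ∑-coefficient (suc n) H k = cong (ℚ._+ H (suc n) k) (∑-coefficient n H k)

  ⊗≈⋆ : ∀ F G → F ⊗ G ≈ F ℚ[[u]][[t]].⋆ G
  ⊗≈⋆ F G n k = ≡.trans (coefficient-⊗ F G n k) (≡.sym (∑-coefficient n _ k))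

  neg : FPS → FPS
  neg F n k = ℚ.- F n k

  const≈constant : ∀ a → const a ≈ ℚ[[u]][[t]].constant (ℚ[[u]].constant a)
  const≈constant a zero zero = refl
  const≈constant a zero (suc k) = refl
  const≈constant a (suc n) zero = refl
  const≈constant a (suc n) (suc k) = refl

  constant-zero : ∀ k → ℚ[[u]].constant 0ℚ k ≡ 0ℚ
  constant-zero zero = refl
  constant-zero (suc k) = refl

  ⊕-⊗-rawRing : RawRing _ _
  ⊕-⊗-rawRing = record
    { Carrier = FPS ; _≈_ = _≈_ ; _+_ = _⊕_ ; _*_ = _⊗_ ; -_ = neg ; 0# = 𝟘 ; 1# = 𝟙 }

  -- FPS with ⊗ is ℚ[[u]][[t]] up to the identity map; its ring laws are inherited along it.
  id-isRingMonomorphism :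
    IsRingMonomorphism ⊕-⊗-rawRing (CommutativeRing.rawRing ℚ[[u]][[t]].⊹-⋆-commutativeRing) id
  id-isRingMonomorphism = record
    { isRingHomomorphism = record
      { isSemiringHomomorphism = record
        { isNearSemiringHomomorphism = record
          { +-isMonoidHomomorphism = record
            { isMagmaHomomorphism = record
              { isRelHomomorphism = record { cong = id } ; homo = λ F G n k → refl }
            ; ε-homo = const≈constant 0ℚ }
          ; *-homo = ⊗≈⋆ }
        ; 1#-homo = const≈constant 1ℚ }
      ; -‿homo = λ F n k → refl }
    ; injective = id }

  ⊕-⊗-commutativeRing : CommutativeRing _ _
  ⊕-⊗-commutativeRing = record
    { isCommutativeRing = RingMonomorphism.isCommutativeRing id-isRingMonomorphism
        (CommutativeRing.isCommutativeRing ℚ[[u]][[t]].⊹-⋆-commutativeRing) }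

  tS≈var : tS ≈ ℚ[[u]][[t]].var
  tS≈var zero zero = refl
  tS≈var zero (suc k) = refl
  tS≈var (suc zero) zero = refl
  tS≈var (suc zero) (suc k) = refl
  tS≈var (suc (suc n)) zero = refl
  tS≈var (suc (suc n)) (suc k) = refl

  uS≈var : uS ≈ ℚ[[u]][[t]].constant ℚ[[u]].var
  uS≈var zero zero = refl
  uS≈var zero (suc zero) = refl
  uS≈var zero (suc (suc k)) = refl
  uS≈var (suc n) zero = refl
  uS≈var (suc n) (suc k) = refl

  tS-⊗-zero : ∀ F k → (tS ⊗ F) 0 k ≡ 0ℚ
  tS-⊗-zero F k = ≡.trans (⊗≈⋆ tS F 0 k) (≡.trans (ℚ[[u]][[t]].⋆-cong {g = F} tS≈var (λ _ _ → refl) 0 k)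
    (≡.trans (ℚ[[u]][[t]].var-⋆-zero F k) (constant-zero k)))

  tS-⊗-suc : ∀ F n k → (tS ⊗ F) (suc n) k ≡ F n k
  tS-⊗-suc F n k = ≡.trans (⊗≈⋆ tS F (suc n) k)
    (≡.trans (ℚ[[u]][[t]].⋆-cong {g = F} tS≈var (λ _ _ → refl) (suc n) k)
      (ℚ[[u]][[t]].var-⋆-suc F n k))

  uS-⊗ : ∀ F n k → (uS ⊗ F) n k ≡ (ℚ[[u]].var ℚ[[u]].⋆ F n) k
  uS-⊗ F n k = ≡.trans (⊗≈⋆ uS F n k)
    (≡.trans (ℚ[[u]][[t]].⋆-cong {g = F} uS≈var (λ _ _ → refl) n k)
      (ℚ[[u]][[t]].constant-⋆ ℚ[[u]].var F n k))

  uS-⊗-zero : ∀ F n → (uS ⊗ F) n 0 ≡ 0ℚ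
  uS-⊗-zero F n = ≡.trans (uS-⊗ F n 0) (ℚ[[u]].var-⋆-zero (F n))

  uS-⊗-suc : ∀ F n k → (uS ⊗ F) n (suc k) ≡ F n k
  uS-⊗-suc F n k = ≡.trans (uS-⊗ F n (suc k)) (ℚ[[u]].var-⋆-suc (F n) k)

  ⊗-cong-≋[] : ∀ {n F F′ G G′} → F ≋[ n ] F′ → G ≋[ n ] G′ → F ⊗ G ≋[ n ] F′ ⊗ G′
  ⊗-cong-≋[] {n} {F} {F′} {G} {G′} F≋F′ G≋G′ =
    ≋[]-trans {n} {F ⊗ G} (≋⇒≋[] (⊗≈⋆ F G)) (≋[]-trans {n} (ℚ[[u]][[t]].⋆-cong-≋[] F≋F′ G≋G′)
      (≋⇒≋[] (λ m k → ≡.sym (⊗≈⋆ F′ G′ m k))))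

  infix 4 t∣_
  t∣_ : FPS → Set
  t∣ C = ∀ k → C 0 k ≡ 0ℚ

  t∣-⊗ : ∀ {C} F → t∣ C → t∣ (C ⊗ F)
  t∣-⊗ {C} F t∣C k = ≡.trans (coefficient-⊗ C F 0 k) (ℚ[[u]].∑-zero k _ (λ b _ →
    ≡.trans (cong (ℚ._* F 0 (k ∸ b)) (t∣C b)) (ℚ.*-zeroˡ (F 0 (k ∸ b)))))

  ⊗-raise-≋[] : ∀ {n C F G} → t∣ C → F ≋[ n ] G → C ⊗ F ≋[ suc n ] C ⊗ G
  ⊗-raise-≋[] {n} {C} {F} {G} t∣C F≋G =
    ≋[]-trans {suc n} {C ⊗ F} (≋⇒≋[] (⊗≈⋆ C F)) (≋[]-trans {suc n} (ℚ[[u]][[t]].⋆-raise-≋[] {f = C} C₀≈0 F≋G)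
      (≋⇒≋[] (λ m k → ≡.sym (⊗≈⋆ C G m k))))
    where
    C₀≈0 : ∀ k → C 0 k ≡ ℚ[[u]].constant 0ℚ k
    C₀≈0 k = ≡.trans (t∣C k) (≡.sym (constant-zero k))

  IsUnit : FPS → Set
  IsUnit U = Σ[ c ∈ ℚ ] Σ[ c⁻¹ ∈ ℚ ] (c⁻¹ ℚ.* c ≡ 1ℚ) × (U ≋[ 1 ] const c)

  ⊗-cancelˡ-≋[] : ∀ {n U F G} → IsUnit U → U ⊗ F ≋[ n ] U ⊗ G → F ≋[ n ] G
  ⊗-cancelˡ-≋[] {n} {U} {F} {G} (c , c⁻¹ , c⁻¹c≡1 , U≋c) UF≋UG =
    ℚ[[u]][[t]].⋆-cancelˡ-≋[] {f = U} cancel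
      (≋[]-trans {n} (≋⇒≋[] (λ m k → ≡.sym (⊗≈⋆ U F m k)))
        (≋[]-trans {n} UF≋UG (≋⇒≋[] (⊗≈⋆ U G))))
    where
    U₀≈c : ∀ k → U 0 k ≡ ℚ[[u]].constant c k
    U₀≈c zero = U≋c 0 (s≤s z≤n) zero
    U₀≈c (suc k) = U≋c 0 (s≤s z≤n) (suc k)
    cancel : ∀ x y → U 0 ℚ[[u]].⋆ x ℚ[[u]].≋ U 0 ℚ[[u]].⋆ y → x ℚ[[u]].≋ y
    cancel x y Ux≋Uy k = begin
      x k                       ≡⟨ ℚ.*-identityˡ (x k) ⟨
      1ℚ ℚ.* x k                ≡⟨ cong (ℚ._* x k) c⁻¹c≡1 ⟨
      (c⁻¹ ℚ.* c) ℚ.* x k       ≡⟨ ℚ.*-assoc c⁻¹ c (x k) ⟩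
      c⁻¹ ℚ.* (c ℚ.* x k)       ≡⟨ cong (c⁻¹ ℚ.*_) (scale x) ⟨
      c⁻¹ ℚ.* (U 0 ℚ[[u]].⋆ x) k ≡⟨ cong (c⁻¹ ℚ.*_) (Ux≋Uy k) ⟩
      c⁻¹ ℚ.* (U 0 ℚ[[u]].⋆ y) k ≡⟨ cong (c⁻¹ ℚ.*_) (scale y) ⟩
      c⁻¹ ℚ.* (c ℚ.* y k)       ≡⟨ ℚ.*-assoc c⁻¹ c (y k) ⟨
      (c⁻¹ ℚ.* c) ℚ.* y k       ≡⟨ cong (ℚ._* y k) c⁻¹c≡1 ⟩
      1ℚ ℚ.* y k                ≡⟨ ℚ.*-identityˡ (y k) ⟩
      y k                       ∎
      where
      open ≡.≡-Reasoning
      scale : ∀ z → (U 0 ℚ[[u]].⋆ z) k ≡ c ℚ.* z k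
      scale z = ≡.trans (ℚ[[u]].⋆-cong {g = z} U₀≈c (λ _ → refl) k) (ℚ[[u]].constant-⋆ c z k)

  ⊗-cancelˡ : ∀ {U F G} → IsUnit U → U ⊗ F ≈ U ⊗ G → F ≈ G
  ⊗-cancelˡ {U} {F} {G} unit UF≈UG =
    ≋[]⇒≋ (λ n → ⊗-cancelˡ-≋[] {n} {U} {F} {G} unit (≋⇒≋[] UF≈UG))

module Solver where
  open import Algebra.Morphism.Structures using (IsRingMonomorphism)
  import Algebra.Morphism.RingMonomorphism as RingMonomorphism
  open import Data.Maybe using (Maybe; just; nothing)
  open import Data.Nat using (ℕ; zero; suc)
  open import Data.Product using (_×_; _,_; proj₁; proj₂)
  open import Data.Rational as ℚ using (ℚ; 0ℚ; 1ℚ)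
  import Data.Rational.Properties as ℚ
  open import Data.Vec.N-ary using (N-ary)
  open import Relation.Binary.PropositionalEquality as ≡ using (_≡_; refl)
  open import Relation.Nullary using (yes; no)
  open import Tactic.RingSolver.Core.AlmostCommutativeRing using (fromCommutativeRing)
  import Tactic.RingSolver.NonReflective as NonReflective
  import Tactic.RingSolver.Core.Polynomial.Semantics as Semantics

  open import Defs
  open SeriesRing

  private
    module 𝓕 = CommutativeRing ⊕-⊗-commutativeRing

  -- Rational constants are kept as literals, so that the normaliser can decide whether a
  -- coefficient vanishes and normal forms can be compared by computation.  The operations
  -- inspect both arguments: evaluating an expression on series then yields literally the FPS
  -- term it denotes, and conversion checking never has to unfold a product of series.
  data FPSₗ : Set where
    lit : ℚ → FPSₗ
    ser : FPS → FPSₗ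

  ⟦_⟧ : FPSₗ → FPS
  ⟦ lit a ⟧ = const a
  ⟦ ser F ⟧ = F

  infix 4 _≈ₗ_
  record _≈ₗ_ (x y : FPSₗ) : Set where
    constructor lift
    field lower : ⟦ x ⟧ ≈ ⟦ y ⟧
  open _≈ₗ_ public

  infixl 6 _+ₗ_
  infixl 7 _*ₗ_

  _+ₗ_ : FPSₗ → FPSₗ → FPSₗ
  lit a +ₗ lit b = lit (a ℚ.+ b)
  lit a +ₗ ser G = ser (const a ⊕ G)
  ser F +ₗ lit b = ser (F ⊕ const b)
  ser F +ₗ ser G = ser (F ⊕ G)

  _*ₗ_ : FPSₗ → FPSₗ → FPSₗ
  lit a *ₗ lit b = lit (a ℚ.* b)
  lit a *ₗ ser G = ser (const a ⊗ G)
  ser F *ₗ lit b = ser (F ⊗ const b)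
  ser F *ₗ ser G = ser (F ⊗ G)

  -ₗ_ : FPSₗ → FPSₗ
  -ₗ lit a = lit (ℚ.- a)
  -ₗ ser F = ser (neg F)

  const-+ : ∀ a b → const (a ℚ.+ b) ≈ const a ⊕ const b
  const-+ a b zero zero = refl
  const-+ a b zero (suc k) = refl
  const-+ a b (suc n) k = refl

  const-neg : ∀ a → const (ℚ.- a) ≈ neg (const a)
  const-neg a zero zero = refl
  const-neg a zero (suc k) = refl
  const-neg a (suc n) k = refl

  const-* : ∀ a b → const (a ℚ.* b) ≈ const a ⊗ const b
  const-* a b n k = ≡.sym (begin
    (const a ⊗ const b) n k
      ≡⟨ ⊗≈⋆ (const a) (const b) n k ⟩
    (const a ℚ[[u]][[t]].⋆ const b) n k
      ≡⟨ ℚ[[u]][[t]].⋆-cong {g = const b} (const≈constant a) (λ _ _ → refl) n k ⟩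
    (ℚ[[u]][[t]].constant (ℚ[[u]].constant a) ℚ[[u]][[t]].⋆ const b) n k
      ≡⟨ ℚ[[u]][[t]].constant-⋆ _ (const b) n k ⟩
    (ℚ[[u]].constant a ℚ[[u]].⋆ const b n) k
      ≡⟨ ℚ[[u]].constant-⋆ a (const b n) k ⟩
    a ℚ.* const b n k
      ≡⟨ scale n k ⟩
    const (a ℚ.* b) n k ∎)
    where
    open ≡.≡-Reasoning
    scale : ∀ n k → a ℚ.* const b n k ≡ const (a ℚ.* b) n k
    scale zero zero = refl
    scale zero (suc k) = ℚ.*-zeroʳ a
    scale (suc n) k = ℚ.*-zeroʳ a

  ⟦⟧-+ : ∀ x y → ⟦ x +ₗ y ⟧ ≈ ⟦ x ⟧ ⊕ ⟦ y ⟧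
  ⟦⟧-+ (lit a) (lit b) = const-+ a b
  ⟦⟧-+ (lit a) (ser G) = 𝓕.refl
  ⟦⟧-+ (ser F) (lit b) = 𝓕.refl
  ⟦⟧-+ (ser F) (ser G) = 𝓕.refl

  ⟦⟧-* : ∀ x y → ⟦ x *ₗ y ⟧ ≈ ⟦ x ⟧ ⊗ ⟦ y ⟧
  ⟦⟧-* (lit a) (lit b) = const-* a b
  ⟦⟧-* (lit a) (ser G) = 𝓕.refl
  ⟦⟧-* (ser F) (lit b) = 𝓕.refl
  ⟦⟧-* (ser F) (ser G) = 𝓕.refl

  ⟦⟧-neg : ∀ x → ⟦ -ₗ x ⟧ ≈ neg ⟦ x ⟧
  ⟦⟧-neg (lit a) = const-neg a
  ⟦⟧-neg (ser F) = 𝓕.refl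

  rawRingₗ : RawRing _ _
  rawRingₗ = record
    { Carrier = FPSₗ ; _≈_ = _≈ₗ_ ; _+_ = _+ₗ_ ; _*_ = _*ₗ_ ; -_ = -ₗ_ ; 0# = lit 0ℚ ; 1# = lit 1ℚ }

  ⟦⟧-isRingMonomorphism : IsRingMonomorphism rawRingₗ 𝓕.rawRing ⟦_⟧
  ⟦⟧-isRingMonomorphism = record
    { isRingHomomorphism = record
      { isSemiringHomomorphism = record
        { isNearSemiringHomomorphism = record
          { +-isMonoidHomomorphism = record
            { isMagmaHomomorphism = record { isRelHomomorphism = record { cong = lower } ; homo = ⟦⟧-+ }
            ; ε-homo = 𝓕.refl }
          ; *-homo = ⟦⟧-* }
        ; 1#-homo = 𝓕.refl }
      ; -‿homo = ⟦⟧-neg }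
    ; injective = lift }

  commutativeRingₗ : CommutativeRing _ _
  commutativeRingₗ = record
    { isCommutativeRing = RingMonomorphism.isCommutativeRing ⟦⟧-isRingMonomorphism 𝓕.isCommutativeRing }

  0≟_ : ∀ x → Maybe (lit 0ℚ ≈ₗ x)
  0≟ lit a with a ℚ.≟ 0ℚ
  ... | yes refl = just (lift 𝓕.refl)
  ... | no _ = nothing
  0≟ ser F = nothing

  module Normalisation = NonReflective (fromCommutativeRing commutativeRingₗ 0≟_)
  open Normalisation.Ops using (norm; close; prove) renaming (⟦_⟧ to ⟦_⟧ₑ)
  open Normalisation using (Expr) public
  open Normalisation using (Κ; ⊝_) renaming (_⊕_ to _⊕ₑ_; _⊗_ to _⊗ₑ_)
  open Semantics Normalisation.Ops.homo using () renaming (⟦_⟧ to ⟦_⟧ₚ)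

  -- Sparse Horner normal forms are canonical, so an identity is proved by evaluating both normal
  -- forms to the same term.
  solve : ∀ n (f : N-ary n (Expr FPSₗ n) (Expr FPSₗ n × Expr FPSₗ n)) →
    norm (proj₁ (close n f)) ≡ norm (proj₂ (close n f)) →
    ∀ ρ → ⟦ proj₁ (close n f) ⟧ₑ ρ ≈ₗ ⟦ proj₂ (close n f) ⟧ₑ ρ
  solve n f norm≡ ρ = prove ρ (proj₁ (close n f)) (proj₂ (close n f))
    (lift (𝓕.reflexive (≡.cong (λ p → ⟦ ⟦ p ⟧ₚ ρ ⟧) norm≡)))

  infixl 6 _:+_ _:-_
  infixl 7 _:*_
  _:+_ _:*_ _:-_ : ∀ {n} → Expr FPSₗ n → Expr FPSₗ n → Expr FPSₗ n
  x :+ y = x ⊕ₑ y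
  x :* y = x ⊗ₑ y
  x :- y = x ⊕ₑ (⊝ y)

  :-_ : ∀ {n} → Expr FPSₗ n → Expr FPSₗ n
  :- x = ⊝ x

  con : ∀ {n} → ℚ → Expr FPSₗ n
  con a = Κ (lit a)

  infix 4 _:=_
  _:=_ : ∀ {n} → Expr FPSₗ n → Expr FPSₗ n → Expr FPSₗ n × Expr FPSₗ n
  _:=_ = _,_

  Expr-rawRing : ℕ → RawRing _ _
  Expr-rawRing n = record
    { Carrier = Expr FPSₗ n ; _≈_ = _≡_ ; _+_ = _:+_ ; _*_ = _:*_ ; -_ = :-_ ; 0# = con 0ℚ ; 1# = con 1ℚ }

  private
    module 𝓛 = CommutativeRing commutativeRingₗ

  vanish : ∀ c {l r} → l ≈ₗ r → c *ₗ (l +ₗ -ₗ r) ≈ₗ lit 0ℚ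
  vanish c {l} {r} l≈r =
    𝓛.trans (𝓛.*-congˡ {c} (𝓛.trans (𝓛.+-congʳ l≈r) (𝓛.-‿inverseʳ r))) (𝓛.zeroʳ c)

  +-vanish : ∀ {a b} → a ≈ₗ lit 0ℚ → b ≈ₗ lit 0ℚ → a +ₗ b ≈ₗ lit 0ℚ
  +-vanish a≈0 b≈0 = 𝓛.trans (𝓛.+-cong a≈0 b≈0) (𝓛.+-identityʳ (lit 0ℚ))

  drop-vanishing : ∀ {l r z} → l ≈ₗ r +ₗ z → z ≈ₗ lit 0ℚ → l ≈ₗ r
  drop-vanishing {r = r} l≈r+z z≈0 =
    𝓛.trans l≈r+z (𝓛.trans (𝓛.+-congˡ {r} z≈0) (𝓛.+-identityʳ r))

  _≈ₜ_ : FPSₗ → FPSₗ → Set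
  a ≈ₜ b = ⟦ a ⟧ ≋[ 1 ] ⟦ b ⟧

  +-congₜ : ∀ {a a′ b b′} → a ≈ₜ a′ → b ≈ₜ b′ → (a +ₗ b) ≈ₜ (a′ +ₗ b′)
  +-congₜ {a} {a′} {b} {b′} a≈ₜa′ b≈ₜb′ = ≋[]-trans {1} {⟦ a +ₗ b ⟧} (≋⇒≋[] (⟦⟧-+ a b))
    (≋[]-trans {1} {⟦ a ⟧ ⊕ ⟦ b ⟧} (⊕-cong-≋[] {1} {⟦ a ⟧} a≈ₜa′ b≈ₜb′)
      (≋⇒≋[] (𝓕.sym (⟦⟧-+ a′ b′))))

  *-congₜ : ∀ {a a′ b b′} → a ≈ₜ a′ → b ≈ₜ b′ → (a *ₗ b) ≈ₜ (a′ *ₗ b′)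
  *-congₜ {a} {a′} {b} {b′} a≈ₜa′ b≈ₜb′ = ≋[]-trans {1} {⟦ a *ₗ b ⟧} (≋⇒≋[] (⟦⟧-* a b))
    (≋[]-trans {1} {⟦ a ⟧ ⊗ ⟦ b ⟧} (⊗-cong-≋[] {1} {⟦ a ⟧} a≈ₜa′ b≈ₜb′)
      (≋⇒≋[] (𝓕.sym (⟦⟧-* a′ b′))))

  -‿congₜ : ∀ {a a′} → a ≈ₜ a′ → (-ₗ a) ≈ₜ (-ₗ a′)
  -‿congₜ {a} {a′} a≈ₜa′ = ≋[]-trans {1} {⟦ -ₗ a ⟧} (≋⇒≋[] (⟦⟧-neg a))
    (≋[]-trans {1} {neg ⟦ a ⟧} (neg-cong-≋[] {1} {⟦ a ⟧} a≈ₜa′) (≋⇒≋[] (𝓕.sym (⟦⟧-neg a′))))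

  product-unit : ∀ a b {c} → (a *ₗ b) ≈ₜ lit c → c ℚ.* c ≡ 1ℚ → IsUnit (⟦ a ⟧ ⊗ ⟦ b ⟧)
  product-unit a b {c} ab≈ₜc c²≡1 =
    c , c , c²≡1 , ≋[]-trans {1} {⟦ a ⟧ ⊗ ⟦ b ⟧} (≋⇒≋[] (𝓕.sym (⟦⟧-* a b))) ab≈ₜc

  cancel : ∀ u k → IsUnit ⟦ u ⟧ → u *ₗ k ≈ₗ lit 0ℚ → k ≈ₗ lit 0ℚ
  cancel u k unit uk≈0 = lift (⊗-cancelˡ {⟦ u ⟧} {⟦ k ⟧} {𝟘} unit
    (𝓕.trans (𝓕.sym (⟦⟧-* u k)) (𝓕.trans (lower uk≈0) (𝓕.sym (𝓕.zeroʳ ⟦ u ⟧)))))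

  ⟦⟧-*-*ʳ : ∀ a b c → ⟦ a *ₗ (b *ₗ c) ⟧ ≈ ⟦ a ⟧ ⊗ (⟦ b ⟧ ⊗ ⟦ c ⟧)
  ⟦⟧-*-*ʳ a b c = 𝓕.trans (⟦⟧-* a (b *ₗ c)) (𝓕.*-congˡ {⟦ a ⟧} (⟦⟧-* b c))

  ⟦⟧-recurrence : ∀ c n₁ n₂ n′ d₁ d₂ d′ →
    n₁ *ₗ (d₂ *ₗ d′) ≈ₗ d₁ *ₗ (d₂ *ₗ d′) +ₗ c *ₗ (n₂ *ₗ (n₁ *ₗ n′)) →
    ⟦ n₁ ⟧ ⊗ (⟦ d₂ ⟧ ⊗ ⟦ d′ ⟧) ≈ ⟦ d₁ ⟧ ⊗ (⟦ d₂ ⟧ ⊗ ⟦ d′ ⟧) ⊕ ⟦ c ⟧ ⊗ (⟦ n₂ ⟧ ⊗ (⟦ n₁ ⟧ ⊗ ⟦ n′ ⟧))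
  ⟦⟧-recurrence c n₁ n₂ n′ d₁ d₂ d′ e = 𝓕.trans (𝓕.sym (⟦⟧-*-*ʳ n₁ d₂ d′)) (𝓕.trans (lower e)
    (𝓕.trans (⟦⟧-+ (d₁ *ₗ (d₂ *ₗ d′)) (c *ₗ (n₂ *ₗ (n₁ *ₗ n′))))
      (𝓕.+-cong (⟦⟧-*-*ʳ d₁ d₂ d′)
        (𝓕.trans (⟦⟧-* c (n₂ *ₗ (n₁ *ₗ n′))) (𝓕.*-congˡ {⟦ c ⟧} (⟦⟧-*-*ʳ n₂ n₁ n′))))))

-- With x = X and q = X^(j+1): H T(u) q = H_(j-1)(u), and the plain and core generating functions
-- are S_j = Nᵖ T q / Dᵖ q and T_j(u) = Nᶜ T(u) q / Dᶜ T(u) q.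

module ClosedForms {c ℓ} (R : RawRing c ℓ) (x : RawRing.Carrier R) where
  open import Data.Nat using (ℕ; zero; suc)

  open RawRing R

  infixl 6 _-_
  _-_ : Carrier → Carrier → Carrier
  a - b = a + - b

  x^[_]·_ : ℕ → Carrier → Carrier
  x^[ zero ]· q = q
  x^[ suc m ]· q = x * x^[ m ]· q

  1-x^[_]·_ : ℕ → Carrier → Carrier
  1-x^[ m ]· q = 1# - x^[ m ]· q

  H : Carrier → Carrier → Carrier
  H W q = (x - q) * W - (1# + x) * (1# - q)

  Dᵖ : Carrier → Carrier
  Dᵖ q = 1-x^[ 2 ]· q * 1-x^[ 3 ]· q

  Nᵖ : Carrier → Carrier → Carrier
  Nᵖ T q = T * (1-x^[ 1 ]· q * 1-x^[ 4 ]· q)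

  Dᶜ : Carrier → Carrier → Carrier
  Dᶜ W q = H W q * 1-x^[ 2 ]· q

  Nᶜ : Carrier → Carrier → Carrier
  Nᶜ W q = W * H W (x * q) * 1-x^[ 1 ]· q

  K : Carrier → Carrier → Carrier
  K T q = T * (1-x^[ 2 ]· q * 1-x^[ 5 ]· q - 1-x^[ 1 ]· q * 1-x^[ 6 ]· q)
    + 1-x^[ 1 ]· q * 1-x^[ 6 ]· q - 1-x^[ 3 ]· q * 1-x^[ 4 ]· q

module FormsCongruence {c ℓ r} (R : RawRing c ℓ)
  (_∼_ : Rel (RawRing.Carrier R) r) (∼-refl : Reflexive _∼_)
  (+-cong : Congruent₂ _∼_ (RawRing._+_ R)) (*-cong : Congruent₂ _∼_ (RawRing._*_ R))
  (-‿cong : Congruent₁ _∼_ (RawRing.-_ R)) where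
  open import Data.Nat using (zero; suc)

  private
    module F = ClosedForms R

    x^[]·-cong : ∀ m {x x′ q q′} → x ∼ x′ → q ∼ q′ → F.x^[_]·_ x m q ∼ F.x^[_]·_ x′ m q′
    x^[]·-cong zero x∼x′ q∼q′ = q∼q′
    x^[]·-cong (suc m) x∼x′ q∼q′ = *-cong x∼x′ (x^[]·-cong m x∼x′ q∼q′)

    1-x^[]·-cong : ∀ m {x x′ q q′} → x ∼ x′ → q ∼ q′ → F.1-x^[_]·_ x m q ∼ F.1-x^[_]·_ x′ m q′
    1-x^[]·-cong m x∼x′ q∼q′ = +-cong ∼-refl (-‿cong (x^[]·-cong m x∼x′ q∼q′))

    H-cong : ∀ {x x′ W W′ q q′} → x ∼ x′ → W ∼ W′ → q ∼ q′ → F.H x W q ∼ F.H x′ W′ q′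
    H-cong x∼x′ W∼W′ q∼q′ = +-cong (*-cong (+-cong x∼x′ (-‿cong q∼q′)) W∼W′)
      (-‿cong (*-cong (+-cong ∼-refl x∼x′) (+-cong ∼-refl (-‿cong q∼q′))))

  Dᵖ-cong : ∀ {x x′ q q′} → x ∼ x′ → q ∼ q′ → F.Dᵖ x q ∼ F.Dᵖ x′ q′
  Dᵖ-cong x∼x′ q∼q′ = *-cong (1-x^[]·-cong 2 x∼x′ q∼q′) (1-x^[]·-cong 3 x∼x′ q∼q′)

  Dᶜ-cong : ∀ {x x′ W W′ q q′} → x ∼ x′ → W ∼ W′ → q ∼ q′ → F.Dᶜ x W q ∼ F.Dᶜ x′ W′ q′
  Dᶜ-cong x∼x′ W∼W′ q∼q′ = *-cong (H-cong x∼x′ W∼W′ q∼q′) (1-x^[]·-cong 2 x∼x′ q∼q′)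

  Nᶜ-cong : ∀ {x x′ W W′ q q′} → x ∼ x′ → W ∼ W′ → q ∼ q′ → F.Nᶜ x W q ∼ F.Nᶜ x′ W′ q′
  Nᶜ-cong x∼x′ W∼W′ q∼q′ =
    *-cong (*-cong W∼W′ (H-cong x∼x′ W∼W′ (*-cong x∼x′ q∼q′))) (1-x^[]·-cong 1 x∼x′ q∼q′)

module Recurrence where
  open import Data.Nat using (ℕ; zero; suc)
  open import Data.Rational using (1ℚ)
  open import Data.Vec using (_∷_; [])
  open import Relation.Binary.PropositionalEquality using (refl)

  open import Defs
  open SeriesRing
  open Solver

  private
    module 𝓕 = CommutativeRing ⊕-⊗-commutativeRing
  open import Relation.Binary.Reasoning.Setoid 𝓕.setoid

  -- Induction on the order of agreement of Fᵢ Dᵢ with Nᵢ, for all i at once: the unknowns only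
  -- enter multiplied by C, which raises the order by one.  Gᵢ need only be known to that order.
  recurrence-uniqueness : (C : FPS) → t∣ C → (F G N D N′ D′ : ℕ → FPS) →
    F 0 ≈ 𝟙 → D 0 ≈ N 0 →
    (∀ i → F (suc i) ≈ 𝟙 ⊕ C ⊗ (F (suc (suc i)) ⊗ (F (suc i) ⊗ G i))) →
    (∀ n → (∀ i → F i ⊗ D i ≋[ n ] N i) → ∀ i → G i ⊗ D′ i ≋[ n ] N′ i) →
    (∀ i → N (suc i) ⊗ (D (suc (suc i)) ⊗ D′ i)
           ≈ D (suc i) ⊗ (D (suc (suc i)) ⊗ D′ i) ⊕ C ⊗ (N (suc (suc i)) ⊗ (N (suc i) ⊗ N′ i))) →
    (∀ i → IsUnit (D (suc (suc i)) ⊗ D′ i)) →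
    ∀ i → F i ⊗ D i ≈ N i
  recurrence-uniqueness C t∣C F G N D N′ D′ F₀≈1 D₀≈N₀ F-rec G-agrees ND-rec unit i =
    ≋[]⇒≋ (λ n → agree n i)
    where
    agree : ∀ n i → F i ⊗ D i ≋[ n ] N i
    agree zero i m ()
    agree (suc n) zero = ≋⇒≋[] (begin
      F 0 ⊗ D 0  ≈⟨ 𝓕.*-congʳ F₀≈1 ⟩
      𝟙 ⊗ D 0    ≈⟨ 𝓕.*-identityˡ (D 0) ⟩
      D 0        ≈⟨ D₀≈N₀ ⟩
      N 0        ∎)
    agree (suc n) (suc i) = ⊗-cancelˡ-≋[] {suc n} {E} (unit i)
      (≋[]-trans {suc n} {E ⊗ (F₁ ⊗ D₁)} {D₁ ⊗ E ⊕ C ⊗ P} (≋⇒≋[] expand)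
      (≋[]-trans {suc n} {D₁ ⊗ E ⊕ C ⊗ P} {D₁ ⊗ E ⊕ C ⊗ Q}
        (⊕-cong-≋[] {suc n} {D₁ ⊗ E} ≋[]-refl (⊗-raise-≋[] {n} {C} {P} {Q} t∣C products-agree))
        (≋⇒≋[] (𝓕.trans (𝓕.sym (ND-rec i)) (𝓕.*-comm (N (suc i)) E)))))
      where
      F₁ = F (suc i)
      F₂ = F (suc (suc i))
      D₁ = D (suc i)
      D₂ = D (suc (suc i))
      E = D₂ ⊗ D′ i
      P = (F₂ ⊗ D₂) ⊗ ((F₁ ⊗ D₁) ⊗ (G i ⊗ D′ i))
      Q = N (suc (suc i)) ⊗ (N (suc i) ⊗ N′ i)
      products-agree : P ≋[ n ] Q
      products-agree = ⊗-cong-≋[] {n} {F₂ ⊗ D₂} (agree n (suc (suc i)))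
        (⊗-cong-≋[] {n} {F₁ ⊗ D₁} (agree n (suc i)) (G-agrees n (agree n) i))
      expand : E ⊗ (F₁ ⊗ D₁) ≈ D₁ ⊗ E ⊕ C ⊗ P
      expand = begin
        E ⊗ (F₁ ⊗ D₁)
          ≈⟨ 𝓕.*-congˡ {E} (𝓕.*-congʳ {D₁} (F-rec i)) ⟩
        E ⊗ ((𝟙 ⊕ C ⊗ (F₂ ⊗ (F₁ ⊗ G i))) ⊗ D₁)
          ≈⟨ lower (solve 7 (λ C D₁ D₂ D′ F₁ F₂ G →
               (D₂ :* D′) :* ((con 1ℚ :+ C :* (F₂ :* (F₁ :* G))) :* D₁)
               := D₁ :* (D₂ :* D′) :+ C :* ((F₂ :* D₂) :* ((F₁ :* D₁) :* (G :* D′))))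
             refl (ser C ∷ ser D₁ ∷ ser D₂ ∷ ser (D′ i) ∷ ser F₁ ∷ ser F₂ ∷ ser (G i) ∷ [])) ⟩
        D₁ ⊗ E ⊕ C ⊗ P ∎

module Trees where
  open import Data.Bool using (Bool; true; false; _∧_; if_then_else_)
  open import Data.Bool.Properties using (∧-zeroʳ)
  open import Data.Integer as ℤ using (ℤ; +_; -[1+_])
  import Data.Integer.Properties as ℤ
  open import Data.List using (List; []; _∷_; _++_; concatMap; concat; map; foldr; filter; length)
  open import Data.List.Properties using (filter-accept; filter-reject)
  open import Data.Nat as ℕ using (ℕ; zero; suc)
  import Data.Nat.Properties as ℕ
  open import Data.Rational as ℚ using (ℚ; 0ℚ; 1ℚ)
  import Data.Rational.Properties as ℚ
  import Data.Rational.Unnormalised as ℚᵘ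
  import Data.Rational.Unnormalised.Properties as ℚᵘ
  open import Data.Vec using (_∷_; [])
  open import Data.Product using (_×_; _,_)
  open import Function using (_∘_)
  open import Relation.Binary.PropositionalEquality as ≡ using (_≡_; refl)
  import Relation.Binary.Reasoning.Setoid as SetoidReasoning
  open import Relation.Nullary using (Dec; yes; no)
  open import Relation.Nullary.Decidable using (⌊_⌋; does; T?; dec-true; dec-false; isYes≗does)
  open import Relation.Unary using (Pred; Decidable)

  open import Defs
  open SeriesRing
  open Solver

  private
    module 𝓕 = CommutativeRing ⊕-⊗-commutativeRing

  ^S-distribˡ-+-⊗ : ∀ F a b → F ^S (a ℕ.+ b) ≈ F ^S a ⊗ F ^S b
  ^S-distribˡ-+-⊗ F zero b = 𝓕.sym (𝓕.*-identityˡ _)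
  ^S-distribˡ-+-⊗ F (suc a) b =
    𝓕.trans (𝓕.*-congˡ {F} (^S-distribˡ-+-⊗ F a b)) (𝓕.sym (𝓕.*-assoc F (F ^S a) (F ^S b)))

  monomial : ℕ → ℕ → FPS
  monomial a b = tS ^S a ⊗ uS ^S b

  indicator : Bool → ℚ
  indicator true = 1ℚ
  indicator false = 0ℚ

  coefficient-uS^ : ∀ b n k → (uS ^S b) n k ≡ indicator (does (0 ℕ.≟ n) ∧ does (b ℕ.≟ k))
  coefficient-uS^ zero zero zero = refl
  coefficient-uS^ zero zero (suc k) = refl
  coefficient-uS^ zero (suc n) k = refl
  coefficient-uS^ (suc b) zero zero = uS-⊗-zero (uS ^S b) 0
  coefficient-uS^ (suc b) (suc n) zero = uS-⊗-zero (uS ^S b) (suc n)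
  coefficient-uS^ (suc b) n (suc k) = ≡.trans (uS-⊗-suc (uS ^S b) n k) (coefficient-uS^ b n k)

  coefficient-monomial : ∀ a b n k → monomial a b n k ≡ indicator (does (a ℕ.≟ n) ∧ does (b ℕ.≟ k))
  coefficient-monomial zero b n k = ≡.trans (𝓕.*-identityˡ (uS ^S b) n k) (coefficient-uS^ b n k)
  coefficient-monomial (suc a) b zero k =
    ≡.trans (𝓕.*-assoc tS (tS ^S a) (uS ^S b) 0 k) (tS-⊗-zero (monomial a b) k)
  coefficient-monomial (suc a) b (suc n) k = ≡.trans (𝓕.*-assoc tS (tS ^S a) (uS ^S b) (suc n) k)
    (≡.trans (tS-⊗-suc (monomial a b) n k) (coefficient-monomial a b n k))

  guard : Bool → FPS → FPS
  guard b F = if b then F else 𝟘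

  guard-cong : ∀ b {F G} → F ≈ G → guard b F ≈ guard b G
  guard-cong true F≈G = F≈G
  guard-cong false F≈G = 𝓕.refl

  guard-⊗ : ∀ b c F G → guard (b ∧ c) (F ⊗ G) ≈ guard b F ⊗ guard c G
  guard-⊗ true true F G = 𝓕.refl
  guard-⊗ true false F G = 𝓕.sym (𝓕.zeroʳ F)
  guard-⊗ false c F G = 𝓕.sym (𝓕.zeroˡ (guard c G))

  guard-⊗ˡ : ∀ b C F → guard b (C ⊗ F) ≈ C ⊗ guard b F
  guard-⊗ˡ true C F = 𝓕.refl
  guard-⊗ˡ false C F = 𝓕.sym (𝓕.zeroʳ C)

  guard-𝟘 : ∀ b → guard b 𝟘 ≈ 𝟘
  guard-𝟘 true = 𝓕.refl
  guard-𝟘 false = 𝓕.refl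

  guard-⊕ : ∀ b F G → guard b (F ⊕ G) ≈ guard b F ⊕ guard b G
  guard-⊕ true F G = 𝓕.refl
  guard-⊕ false F G = 𝓕.sym (𝓕.+-identityˡ 𝟘)

  guard-cong-≋[] : ∀ b {n F G} → F ≋[ n ] G → guard b F ≋[ n ] guard b G
  guard-cong-≋[] true F≋G = F≋G
  guard-cong-≋[] false F≋G = ≋[]-refl

  guard-∧-⊗ˡ : ∀ b c C F → guard (b ∧ c) (C ⊗ F) ≈ guard b (C ⊗ guard c F)
  guard-∧-⊗ˡ true c C F = guard-⊗ˡ c C F
  guard-∧-⊗ˡ false c C F = 𝓕.refl

  ∑ₗ : (Tree → FPS) → List Tree → FPS
  ∑ₗ φ = foldr (λ τ acc → φ τ ⊕ acc) 𝟘

  ∑ₗ-cong : ∀ {φ ψ} L → (∀ τ → φ τ ≈ ψ τ) → ∑ₗ φ L ≈ ∑ₗ ψ L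
  ∑ₗ-cong [] φ≈ψ = 𝓕.refl
  ∑ₗ-cong (τ ∷ L) φ≈ψ = 𝓕.+-cong (φ≈ψ τ) (∑ₗ-cong L φ≈ψ)

  ∑ₗ-++ : ∀ φ L M → ∑ₗ φ (L ++ M) ≈ ∑ₗ φ L ⊕ ∑ₗ φ M
  ∑ₗ-++ φ [] M = 𝓕.sym (𝓕.+-identityˡ _)
  ∑ₗ-++ φ (τ ∷ L) M =
    𝓕.trans (𝓕.+-congˡ {φ τ} (∑ₗ-++ φ L M)) (𝓕.sym (𝓕.+-assoc (φ τ) _ _))

  ∑ₗ-concatMap : ∀ φ (f : Tree → List Tree) L → ∑ₗ φ (concatMap f L) ≈ ∑ₗ (λ τ → ∑ₗ φ (f τ)) L
  ∑ₗ-concatMap φ f [] = 𝓕.refl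
  ∑ₗ-concatMap φ f (τ ∷ L) =
    𝓕.trans (∑ₗ-++ φ (f τ) (concat (map f L))) (𝓕.+-congˡ {∑ₗ φ (f τ)} (∑ₗ-concatMap φ f L))

  ∑ₗ-map : ∀ φ (g : Tree → Tree) L → ∑ₗ φ (map g L) ≡ ∑ₗ (φ ∘ g) L
  ∑ₗ-map φ g [] = refl
  ∑ₗ-map φ g (τ ∷ L) = ≡.cong (φ (g τ) ⊕_) (∑ₗ-map φ g L)

  ∑ₗ-additive : ∀ (h : FPS → FPS) → (∀ {F G} → F ≈ G → h F ≈ h G) → h 𝟘 ≈ 𝟘 →
    (∀ F G → h (F ⊕ G) ≈ h F ⊕ h G) → ∀ φ L → h (∑ₗ φ L) ≈ ∑ₗ (h ∘ φ) L
  ∑ₗ-additive h h-cong h-𝟘 h-⊕ φ [] = h-𝟘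
  ∑ₗ-additive h h-cong h-𝟘 h-⊕ φ (τ ∷ L) =
    𝓕.trans (h-⊕ (φ τ) (∑ₗ φ L)) (𝓕.+-congˡ {h (φ τ)} (∑ₗ-additive h h-cong h-𝟘 h-⊕ φ L))

  ⊗-distribˡ-∑ₗ : ∀ C φ L → C ⊗ ∑ₗ φ L ≈ ∑ₗ (λ τ → C ⊗ φ τ) L
  ⊗-distribˡ-∑ₗ C = ∑ₗ-additive (C ⊗_) (𝓕.*-congˡ {C}) (𝓕.zeroʳ C) (𝓕.distribˡ C)

  ⊗-distribʳ-∑ₗ : ∀ C φ L → ∑ₗ φ L ⊗ C ≈ ∑ₗ (λ τ → φ τ ⊗ C) L
  ⊗-distribʳ-∑ₗ C φ L = 𝓕.trans (𝓕.*-comm _ C)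
    (𝓕.trans (⊗-distribˡ-∑ₗ C φ L) (∑ₗ-cong L (λ τ → 𝓕.*-comm C (φ τ))))

  ∑ₗ-⊗ : ∀ φ ψ L M → ∑ₗ φ L ⊗ ∑ₗ ψ M ≈ ∑ₗ (λ σ → ∑ₗ (λ τ → φ σ ⊗ ψ τ) M) L
  ∑ₗ-⊗ φ ψ L M =
    𝓕.trans (⊗-distribʳ-∑ₗ (∑ₗ ψ M) φ L) (∑ₗ-cong L (λ σ → ⊗-distribˡ-∑ₗ (φ σ) ψ M))

  ∑ₗ³-⊗ : ∀ φ ψ χ L →
    ∑ₗ φ L ⊗ (∑ₗ ψ L ⊗ ∑ₗ χ L) ≈ ∑ₗ (λ l → ∑ₗ (λ m → ∑ₗ (λ r → φ l ⊗ (ψ m ⊗ χ r)) L) L) L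
  ∑ₗ³-⊗ φ ψ χ L = 𝓕.trans (𝓕.*-congˡ {∑ₗ φ L} (∑ₗ-⊗ ψ χ L L)) (𝓕.trans (⊗-distribʳ-∑ₗ _ φ L)
    (∑ₗ-cong L (λ l → 𝓕.trans (⊗-distribˡ-∑ₗ (φ l) _ L)
      (∑ₗ-cong L (λ m → ⊗-distribˡ-∑ₗ (φ l) _ L)))))

  -- Plain trees are counted by size alone (u = 1); the right subtree of a node lies outside the
  -- core, so it is always plain.
  data Kind : Set where
    core plain : Kind

  exponent : Kind → Tree → ℕ
  exponent core = coreSize
  exponent plain _ = 0

  nodeWeight : Kind → FPS
  nodeWeight core = tS ⊗ uS
  nodeWeight plain = tS

  weight : Kind → ℤ → Tree → FPS
  weight κ j τ = guard (isPositive j τ) (monomial (size τ) (exponent κ τ))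

  monomial-node : ∀ κ l m r →
    monomial (size (node l m r)) (exponent κ (node l m r))
    ≈ nodeWeight κ ⊗ (monomial (size l) (exponent κ l)
                      ⊗ (monomial (size m) (exponent κ m) ⊗ monomial (size r) 0))
  monomial-node κ l m r = 𝓕.trans (𝓕.*-cong (𝓕.*-congˡ {tS} tS^-split) (uS^-split κ)) (rearrange κ)
    where
    tS^-split : tS ^S (size l ℕ.+ size m ℕ.+ size r) ≈ (tS ^S size l ⊗ tS ^S size m) ⊗ tS ^S size r
    tS^-split = 𝓕.trans (^S-distribˡ-+-⊗ tS (size l ℕ.+ size m) (size r))
      (𝓕.*-congʳ {tS ^S size r} (^S-distribˡ-+-⊗ tS (size l) (size m)))
    U : Kind → FPS
    U core = uS ⊗ (uS ^S coreSize l ⊗ uS ^S coreSize m)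
    U plain = 𝟙
    uS^-split : ∀ κ → uS ^S exponent κ (node l m r) ≈ U κ
    uS^-split core = 𝓕.*-congˡ {uS} (^S-distribˡ-+-⊗ uS (coreSize l) (coreSize m))
    uS^-split plain = 𝓕.refl
    rearrange : ∀ κ → (tS ⊗ ((tS ^S size l ⊗ tS ^S size m) ⊗ tS ^S size r)) ⊗ U κ
      ≈ nodeWeight κ ⊗ (monomial (size l) (exponent κ l)
                        ⊗ (monomial (size m) (exponent κ m) ⊗ monomial (size r) 0))
    rearrange core = lower (solve 7 (λ t u a b c d e →
      (t :* ((a :* b) :* c)) :* (u :* (d :* e)) := (t :* u) :* ((a :* d) :* ((b :* e) :* (c :* con 1ℚ))))
      refl (ser tS ∷ ser uS ∷ ser (tS ^S size l) ∷ ser (tS ^S size m) ∷ ser (tS ^S size r)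
            ∷ ser (uS ^S coreSize l) ∷ ser (uS ^S coreSize m) ∷ []))
    rearrange plain = lower (solve 4 (λ t a b c →
      (t :* ((a :* b) :* c)) :* con 1ℚ := t :* ((a :* con 1ℚ) :* ((b :* con 1ℚ) :* (c :* con 1ℚ))))
      refl (ser tS ∷ ser (tS ^S size l) ∷ ser (tS ^S size m) ∷ ser (tS ^S size r) ∷ []))

  weight-node : ∀ κ j l m r → weight κ j (node l m r)
    ≈ guard (+ 0 ℤ.≤ᵇ j)
        (nodeWeight κ ⊗ (weight κ (j ℤ.+ + 1) l ⊗ (weight κ j m ⊗ weight plain (j ℤ.- + 1) r)))
  weight-node κ j l m r = begin
    guard (b ∧ (bₗ ∧ (bₘ ∧ bᵣ))) (monomial (size (node l m r)) (exponent κ (node l m r)))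
      ≈⟨ guard-cong (b ∧ (bₗ ∧ (bₘ ∧ bᵣ))) (monomial-node κ l m r) ⟩
    guard (b ∧ (bₗ ∧ (bₘ ∧ bᵣ))) (nodeWeight κ ⊗ (Mₗ ⊗ (Mₘ ⊗ Mᵣ)))
      ≈⟨ guard-∧-⊗ˡ b (bₗ ∧ (bₘ ∧ bᵣ)) (nodeWeight κ) (Mₗ ⊗ (Mₘ ⊗ Mᵣ)) ⟩
    guard b (nodeWeight κ ⊗ guard (bₗ ∧ (bₘ ∧ bᵣ)) (Mₗ ⊗ (Mₘ ⊗ Mᵣ)))
      ≈⟨ guard-cong b (𝓕.*-congˡ {nodeWeight κ} (𝓕.trans (guard-⊗ bₗ (bₘ ∧ bᵣ) Mₗ (Mₘ ⊗ Mᵣ))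
           (𝓕.*-congˡ {guard bₗ Mₗ} (guard-⊗ bₘ bᵣ Mₘ Mᵣ)))) ⟩
    guard b (nodeWeight κ ⊗ (guard bₗ Mₗ ⊗ (guard bₘ Mₘ ⊗ guard bᵣ Mᵣ))) ∎
    where
    b = + 0 ℤ.≤ᵇ j
    bₗ = isPositive (j ℤ.+ + 1) l
    bₘ = isPositive j m
    bᵣ = isPositive (j ℤ.- + 1) r
    Mₗ = monomial (size l) (exponent κ l)
    Mₘ = monomial (size m) (exponent κ m)
    Mᵣ = monomial (size r) 0
    open SetoidReasoning 𝓕.setoid

  Index : Set
  Index = Kind × ℤ

  gf≤ : ℕ → Index → FPS
  gf≤ d (κ , j) = ∑ₗ (weight κ j) (treesDepth d)

  step : (Index → FPS) → Index → FPS
  step G (κ , j) =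
    𝟙 ⊕ guard (+ 0 ℤ.≤ᵇ j)
          (nodeWeight κ ⊗ (G (κ , j ℤ.+ + 1) ⊗ (G (κ , j) ⊗ G (plain , j ℤ.- + 1))))

  weight-leaf : ∀ κ j → weight κ j leaf ≈ 𝟙
  weight-leaf core j = 𝓕.*-identityˡ 𝟙
  weight-leaf plain j = 𝓕.*-identityˡ 𝟙

  gf≤-zero : ∀ i → gf≤ 0 i ≈ 𝟙
  gf≤-zero (κ , j) = 𝓕.trans (𝓕.+-identityʳ _) (weight-leaf κ j)

  gf≤-suc : ∀ d i → gf≤ (suc d) i ≈ step (gf≤ d) i
  gf≤-suc d (κ , j) = 𝓕.+-cong (weight-leaf κ j) (begin
    ∑ₗ (weight κ j) (concatMap (λ l → concatMap (λ m → map (node l m) L) L) L)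
      ≈⟨ 𝓕.trans (∑ₗ-concatMap (weight κ j) _ L) (∑ₗ-cong L (λ l →
           𝓕.trans (∑ₗ-concatMap (weight κ j) _ L)
             (∑ₗ-cong L (λ m → 𝓕.reflexive (∑ₗ-map (weight κ j) (node l m) L))))) ⟩
    ∑ₗ (λ l → ∑ₗ (λ m → ∑ₗ (λ r → weight κ j (node l m r)) L) L) L
      ≈⟨ ∑ₗ-cong L (λ l → ∑ₗ-cong L (λ m → ∑ₗ-cong L (λ r → weight-node κ j l m r))) ⟩
    ∑ₗ (λ l → ∑ₗ (λ m → ∑ₗ (λ r → h (A l ⊗ (B m ⊗ D r))) L) L) L
      ≈⟨ 𝓕.sym (𝓕.trans (additive _ L)
           (∑ₗ-cong L (λ l → 𝓕.trans (additive _ L) (∑ₗ-cong L (λ m → additive _ L))))) ⟩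
    h (∑ₗ (λ l → ∑ₗ (λ m → ∑ₗ (λ r → A l ⊗ (B m ⊗ D r)) L) L) L)
      ≈⟨ h-cong (∑ₗ³-⊗ A B D L) ⟨
    h (∑ₗ A L ⊗ (∑ₗ B L ⊗ ∑ₗ D L)) ∎)
    where
    open SetoidReasoning 𝓕.setoid
    L = treesDepth d
    b = + 0 ℤ.≤ᵇ j
    A = weight κ (j ℤ.+ + 1)
    B = weight κ j
    D = weight plain (j ℤ.- + 1)
    h : FPS → FPS
    h F = guard b (nodeWeight κ ⊗ F)
    h-cong : ∀ {F G} → F ≈ G → h F ≈ h G
    h-cong F≈G = guard-cong b (𝓕.*-congˡ {nodeWeight κ} F≈G)
    additive : ∀ φ L → h (∑ₗ φ L) ≈ ∑ₗ (h ∘ φ) L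
    additive = ∑ₗ-additive h h-cong (𝓕.trans (guard-cong b (𝓕.zeroʳ (nodeWeight κ))) (guard-𝟘 b))
      (λ F G → 𝓕.trans (guard-cong b (𝓕.distribˡ (nodeWeight κ) F G)) (guard-⊕ b _ _))

  step-contracting : ∀ n {X Y : Index → FPS} →
    (∀ i → X i ≋[ n ] Y i) → ∀ i → step X i ≋[ suc n ] step Y i
  step-contracting n {X} {Y} X≋Y (κ , j) = ⊕-cong-≋[] {suc n} {𝟙} ≋[]-refl (guard-cong-≋[] (+ 0 ℤ.≤ᵇ j)
    (⊗-raise-≋[] {n} {nodeWeight κ} (t∣nodeWeight κ)
      (⊗-cong-≋[] {n} {X (κ , j ℤ.+ + 1)} (X≋Y _) (⊗-cong-≋[] {n} {X (κ , j)} (X≋Y _) (X≋Y _)))))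
    where
    t∣nodeWeight : ∀ κ → t∣ nodeWeight κ
    t∣nodeWeight core = tS-⊗-zero uS
    t∣nodeWeight plain k = refl

  step-𝟘 : ∀ i → step (λ _ → 𝟘) i ≈ 𝟙
  step-𝟘 (κ , j) = 𝓕.trans (𝓕.+-congˡ {𝟙} (𝓕.trans (guard-cong (+ 0 ℤ.≤ᵇ j)
    (𝓕.trans (𝓕.*-congˡ {nodeWeight κ} (𝓕.zeroˡ (𝟘 ⊗ 𝟘))) (𝓕.zeroʳ (nodeWeight κ))))
    (guard-𝟘 (+ 0 ℤ.≤ᵇ j)))) (𝓕.+-identityʳ 𝟙)

  open ℚ[[u]][[t]].Iteration step step-contracting gf≤ (λ _ → 𝟘)
    (λ i → 𝓕.trans (gf≤-zero i) (𝓕.sym (step-𝟘 i))) gf≤-suc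
    public using (limit; limit-fixed)

  𝟘-coefficient : ∀ n k → 𝟘 n k ≡ 0ℚ
  𝟘-coefficient zero zero = refl
  𝟘-coefficient zero (suc k) = refl
  𝟘-coefficient (suc n) k = refl

  [1+n]/1≡1+n/1 : ∀ n → (+ suc n) ℚ./ 1 ≡ 1ℚ ℚ.+ (+ n) ℚ./ 1
  [1+n]/1≡1+n/1 n = ℚ.toℚᵘ-injective (begin
    ℚ.toℚᵘ ((+ suc n) ℚ./ 1)                 ≈⟨ ℚ.toℚᵘ-fromℚᵘ (ℚᵘ.mkℚᵘ (+ suc n) 0) ⟩
    ℚᵘ.mkℚᵘ (+ suc n) 0                      ≈⟨ ℚᵘ.*≡* (≡.cong (ℤ._* + 1) (≡.sym numerator)) ⟩
    ℚᵘ.mkℚᵘ (+ 1 ℤ.* + 1 ℤ.+ + n ℤ.* + 1) 0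
      ≈⟨ ℚᵘ.+-congʳ (ℚ.toℚᵘ 1ℚ) (ℚ.toℚᵘ-fromℚᵘ (ℚᵘ.mkℚᵘ (+ n) 0)) ⟨
    ℚ.toℚᵘ 1ℚ ℚᵘ.+ ℚ.toℚᵘ ((+ n) ℚ./ 1)      ≈⟨ ℚ.toℚᵘ-homo-+ 1ℚ ((+ n) ℚ./ 1) ⟨
    ℚ.toℚᵘ (1ℚ ℚ.+ (+ n) ℚ./ 1)              ∎)
    where
    open ℚᵘ.≃-Reasoning
    numerator : + 1 ℤ.* + 1 ℤ.+ + n ℤ.* + 1 ≡ + suc n
    numerator = ≡.cong (ℤ._+_ (+ 1)) (ℤ.*-identityʳ (+ n))

  count-filter² : ∀ {p q} {P : Pred Tree p} {Q : Pred Tree q} (P? : Decidable P) (Q? : Decidable Q)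
    (φ : Tree → FPS) n k → (∀ τ → φ τ n k ≡ indicator (does (P? τ) ∧ does (Q? τ))) →
    ∀ L → (+ length (filter Q? (filter P? L))) ℚ./ 1 ≡ ∑ₗ φ L n k
  count-filter² P? Q? φ n k coefficient [] = ≡.sym (𝟘-coefficient n k)
  count-filter² {P = P} {Q} P? Q? φ n k coefficient (τ ∷ L) = by-cases (P? τ) (Q? τ)
    where
    open ≡.≡-Reasoning
    rest = count-filter² P? Q? φ n k coefficient L
    φτ≡ : ∀ a b → does (P? τ) ≡ a → does (Q? τ) ≡ b → φ τ n k ≡ indicator (a ∧ b)
    φτ≡ a b P≡a Q≡b = ≡.trans (coefficient τ) (≡.cong₂ (λ a b → indicator (a ∧ b)) P≡a Q≡b)
    by-cases : Dec (P τ) → Dec (Q τ) →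
      (+ length (filter Q? (filter P? (τ ∷ L)))) ℚ./ 1 ≡ ∑ₗ φ (τ ∷ L) n k
    by-cases (yes p) (yes q) = begin
      (+ length (filter Q? (filter P? (τ ∷ L)))) ℚ./ 1
        ≡⟨ ≡.cong (λ xs → (+ length (filter Q? xs)) ℚ./ 1) (filter-accept P? p) ⟩
      (+ length (filter Q? (τ ∷ filter P? L))) ℚ./ 1
        ≡⟨ ≡.cong (λ xs → (+ length xs) ℚ./ 1) (filter-accept Q? q) ⟩
      (+ suc (length (filter Q? (filter P? L)))) ℚ./ 1
        ≡⟨ [1+n]/1≡1+n/1 (length (filter Q? (filter P? L))) ⟩
      1ℚ ℚ.+ (+ length (filter Q? (filter P? L))) ℚ./ 1
        ≡⟨ ≡.cong₂ ℚ._+_ (≡.sym (φτ≡ true true (dec-true (P? τ) p) (dec-true (Q? τ) q))) rest ⟩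
      φ τ n k ℚ.+ ∑ₗ φ L n k ∎
    by-cases (yes p) (no ¬q) = begin
      (+ length (filter Q? (filter P? (τ ∷ L)))) ℚ./ 1
        ≡⟨ ≡.cong (λ xs → (+ length (filter Q? xs)) ℚ./ 1) (filter-accept P? p) ⟩
      (+ length (filter Q? (τ ∷ filter P? L))) ℚ./ 1
        ≡⟨ ≡.cong (λ xs → (+ length xs) ℚ./ 1) (filter-reject Q? ¬q) ⟩
      (+ length (filter Q? (filter P? L))) ℚ./ 1
        ≡⟨ rest ⟩
      ∑ₗ φ L n k
        ≡⟨ ℚ.+-identityˡ _ ⟨
      0ℚ ℚ.+ ∑ₗ φ L n k
        ≡⟨ ≡.cong (ℚ._+ ∑ₗ φ L n k) (φτ≡ true false (dec-true (P? τ) p) (dec-false (Q? τ) ¬q)) ⟨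
      φ τ n k ℚ.+ ∑ₗ φ L n k ∎
    by-cases (no ¬p) _ = begin
      (+ length (filter Q? (filter P? (τ ∷ L)))) ℚ./ 1
        ≡⟨ ≡.cong (λ xs → (+ length (filter Q? xs)) ℚ./ 1) (filter-reject P? ¬p) ⟩
      (+ length (filter Q? (filter P? L))) ℚ./ 1
        ≡⟨ rest ⟩
      ∑ₗ φ L n k
        ≡⟨ ℚ.+-identityˡ _ ⟨
      0ℚ ℚ.+ ∑ₗ φ L n k
        ≡⟨ ≡.cong (ℚ._+ ∑ₗ φ L n k) (φτ≡ false (does (Q? τ)) (dec-false (P? τ) ¬p) refl) ⟨
      φ τ n k ℚ.+ ∑ₗ φ L n k ∎

  coefficient-guard-monomial : ∀ b a c n k →
    guard b (monomial a c) n k ≡ indicator (does (a ℕ.≟ n) ∧ (b ∧ ⌊ c ℕ.≟ k ⌋))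
  coefficient-guard-monomial true a c n k = ≡.trans (coefficient-monomial a c n k)
    (≡.cong (λ b → indicator (does (a ℕ.≟ n) ∧ b)) (≡.sym (isYes≗does (c ℕ.≟ k))))
  coefficient-guard-monomial false a c n k =
    ≡.trans (𝟘-coefficient n k) (≡.cong indicator (≡.sym (∧-zeroʳ (does (a ℕ.≟ n)))))

  Tgf≈limit : ∀ j → Tgf j ≈ limit (core , j)
  Tgf≈limit j n k =
    count-filter² (λ τ → size τ ℕ.≟ n) (λ τ → T? (isPositive j τ ∧ ⌊ coreSize τ ℕ.≟ k ⌋))
    (weight core j) n k (λ τ → coefficient-guard-monomial (isPositive j τ) (size τ) (coreSize τ) n k)
    (treesDepth n)

  predℤ : ℕ → ℤ
  predℤ zero = -[1+ 0 ]
  predℤ (suc i) = + i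

  limit-base : ∀ κ → limit (κ , predℤ 0) ≈ 𝟙
  limit-base κ = 𝓕.trans (limit-fixed (κ , predℤ 0)) (𝓕.+-identityʳ 𝟙)

  limit-recurrence : ∀ κ i → limit (κ , predℤ (suc i))
    ≈ 𝟙 ⊕ nodeWeight κ ⊗ (limit (κ , predℤ (suc (suc i)))
                           ⊗ (limit (κ , predℤ (suc i)) ⊗ limit (plain , predℤ i)))
  limit-recurrence κ i = 𝓕.trans (limit-fixed (κ , + i)) (𝓕.reflexive (≡.cong₂
    (λ a b → 𝟙 ⊕ nodeWeight κ ⊗ (limit (κ , a) ⊗ (limit (κ , + i) ⊗ limit (plain , b))))
    (≡.cong +_ (ℕ.+-comm i 1)) (+i-1≡predℤ i)))
    where
    +i-1≡predℤ : ∀ i → + i ℤ.- + 1 ≡ predℤ i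
    +i-1≡predℤ zero = refl
    +i-1≡predℤ (suc i) = refl

open import Defs
open SeriesRing using (t∣_)

module Solution (T B X W : FPS)
  (hT : T ≈ 𝟙 ⊕ tS ⊗ T ^S 3) (hB : B ≈ tS ⊗ T ^S 2) (hX : X ≈ B ⊗ (𝟙 ⊕ X ⊕ X ^S 2))
  (hX0 : t∣ X) (hW : W ≈ 𝟙 ⊕ tS ⊗ uS ⊗ W ^S 2 ⊗ T) where
  open import Data.Integer as ℤ using (ℤ; +_; -[1+_])
  import Data.Integer.Properties as ℤ
  open import Data.Nat using (ℕ; zero; suc; s≤s)
  import Data.Nat.Properties as ℕ
  open import Data.Product using (_,_)
  open import Data.Rational as ℚ using (ℚ; 0ℚ; 1ℚ)
  import Data.Rational.Properties as ℚ
  open import Data.Vec using (_∷_; [])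
  open import Relation.Binary.PropositionalEquality as ≡ using (_≡_; refl)

  open SeriesRing
  open Solver
  open Trees
  open Recurrence

  private
    module 𝓕 = CommutativeRing ⊕-⊗-commutativeRing
    module 𝓛 = CommutativeRing commutativeRingₗ

  𝟏 𝟎 𝑻 𝑩 𝑿 𝑾 𝒕 𝒖 : FPSₗ
  𝟏 = lit 1ℚ
  𝟎 = lit 0ℚ
  𝑻 = ser T
  𝑩 = ser B
  𝑿 = ser X
  𝑾 = ser W
  𝒕 = ser tS
  𝒖 = ser uS

  module F = ClosedForms rawRingₗ 𝑿
  module F₀ = ClosedForms rawRingₗ 𝟎

  T-equation : 𝑻 ≈ₗ 𝟏 +ₗ 𝒕 *ₗ (𝑻 *ₗ (𝑻 *ₗ (𝑻 *ₗ 𝟏)))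
  T-equation = lift hT

  B-equation : 𝑩 ≈ₗ 𝒕 *ₗ (𝑻 *ₗ (𝑻 *ₗ 𝟏))
  B-equation = lift hB

  X-equation : 𝑿 ≈ₗ 𝑩 *ₗ (𝟏 +ₗ 𝑿 +ₗ 𝑿 *ₗ (𝑿 *ₗ 𝟏))
  X-equation = lift hX

  W-equation : 𝑾 ≈ₗ 𝟏 +ₗ 𝒕 *ₗ 𝒖 *ₗ (𝑾 *ₗ (𝑾 *ₗ 𝟏)) *ₗ 𝑻
  W-equation = lift hW

  T-quadratic : 𝑻 *ₗ (𝟏 +ₗ 𝑿 *ₗ 𝑿) ≈ₗ 𝟏 +ₗ 𝑿 +ₗ 𝑿 *ₗ 𝑿
  T-quadratic = drop-vanishing (solve 4 (λ T B X t →
      T :* (con 1ℚ :+ X :* X)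
      := (con 1ℚ :+ X :+ X :* X)
         :+ ((con 1ℚ :+ X :+ X :* X) :* (T :- (con 1ℚ :+ t :* (T :* (T :* (T :* con 1ℚ)))))
         :+ ((:- ((con 1ℚ :+ X :+ X :* X) :* T)) :* (B :- t :* (T :* (T :* con 1ℚ)))
         :+ (:- T) :* (X :- B :* (con 1ℚ :+ X :+ X :* (X :* con 1ℚ))))))
      refl (𝑻 ∷ 𝑩 ∷ 𝑿 ∷ 𝒕 ∷ []))
    (+-vanish (vanish (𝟏 +ₗ 𝑿 +ₗ 𝑿 *ₗ 𝑿) T-equation)
      (+-vanish (vanish (-ₗ ((𝟏 +ₗ 𝑿 +ₗ 𝑿 *ₗ 𝑿) *ₗ 𝑻)) B-equation) (vanish (-ₗ 𝑻) X-equation)))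

  module ≈ₜ-Congruence = FormsCongruence rawRingₗ _≈ₜ_ (λ {a} → ≋[]-refl {1} {⟦ a ⟧})
    (λ {a a′ b b′} → +-congₜ {a} {a′} {b} {b′}) (λ {a a′ b b′} → *-congₜ {a} {a′} {b} {b′})
    (λ {a a′} → -‿congₜ {a} {a′})

  X≈ₜ0 : 𝑿 ≈ₜ 𝟎
  X≈ₜ0 zero _ zero = hX0 zero
  X≈ₜ0 zero _ (suc k) = hX0 (suc k)
  X≈ₜ0 (suc m) (s≤s ()) k

  W≈ₜ1 : 𝑾 ≈ₜ 𝟏
  W≈ₜ1 zero _ k = ≡.trans (hW 0 k) (≡.trans (≡.cong (const 1ℚ 0 k ℚ.+_) (t∣rest k))
    (ℚ.+-identityʳ (const 1ℚ 0 k)))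
    where
    t∣rest : t∣ (tS ⊗ uS ⊗ W ^S 2 ⊗ T)
    t∣rest = t∣-⊗ {tS ⊗ uS ⊗ W ^S 2} T (t∣-⊗ {tS ⊗ uS} (W ^S 2) (t∣-⊗ {tS} uS (λ _ → refl)))
  W≈ₜ1 (suc m) (s≤s ()) k

  1+X²-unit : IsUnit ⟦ 𝟏 +ₗ 𝑿 *ₗ 𝑿 ⟧
  1+X²-unit = 1ℚ , 1ℚ , refl ,
    +-congₜ {𝟏} {𝟏} {𝑿 *ₗ 𝑿} {𝟎 *ₗ 𝟎} (≋[]-refl {1} {⟦ 𝟏 ⟧})
      (*-congₜ {𝑿} {𝟎} {𝑿} {𝟎} X≈ₜ0 X≈ₜ0)

  -- The plain recurrence reduces to K = 0, and (1 + X²) K is a multiple of T (1 + X²) − (1 + X + X²).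
  K-vanishes : ∀ q → F.K 𝑻 q ≈ₗ 𝟎
  K-vanishes q = cancel (𝟏 +ₗ 𝑿 *ₗ 𝑿) (F.K 𝑻 q) 1+X²-unit (drop-vanishing (solve 3 (λ T X q →
      let open ClosedForms (Expr-rawRing 3) X in
      (con 1ℚ :+ X :* X) :* K T q
      := con 0ℚ :+ (1-x^[ 2 ]· q :* 1-x^[ 5 ]· q - 1-x^[ 1 ]· q :* 1-x^[ 6 ]· q)
                   :* (T :* (con 1ℚ :+ X :* X) - (con 1ℚ :+ X :+ X :* X)))
      refl (𝑻 ∷ 𝑿 ∷ q ∷ []))
    (vanish (F.1-x^[ 2 ]· q *ₗ F.1-x^[ 5 ]· q F.- F.1-x^[ 1 ]· q *ₗ F.1-x^[ 6 ]· q) T-quadratic))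

  plain-identity : ∀ q → F.Nᵖ 𝑻 (𝑿 *ₗ q) *ₗ (F.Dᵖ (𝑿 *ₗ (𝑿 *ₗ q)) *ₗ F.Dᵖ q)
    ≈ₗ F.Dᵖ (𝑿 *ₗ q) *ₗ (F.Dᵖ (𝑿 *ₗ (𝑿 *ₗ q)) *ₗ F.Dᵖ q)
       +ₗ 𝒕 *ₗ (F.Nᵖ 𝑻 (𝑿 *ₗ (𝑿 *ₗ q)) *ₗ (F.Nᵖ 𝑻 (𝑿 *ₗ q) *ₗ F.Nᵖ 𝑻 q))
  plain-identity q = drop-vanishing (solve 4 (λ T X t q →
      let open ClosedForms (Expr-rawRing 4) X in
      Nᵖ T (X :* q) :* (Dᵖ (X :* (X :* q)) :* Dᵖ q)
      := Dᵖ (X :* q) :* (Dᵖ (X :* (X :* q)) :* Dᵖ q) :+ t :* (Nᵖ T (X :* (X :* q)) :* (Nᵖ T (X :* q) :* Nᵖ T q))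
         :+ (1-x^[ 2 ]· q :* 1-x^[ 3 ]· q :* 1-x^[ 4 ]· q :* 1-x^[ 5 ]· q :* K T q
            :+ 1-x^[ 1 ]· q :* 1-x^[ 2 ]· q :* 1-x^[ 3 ]· q :* 1-x^[ 4 ]· q :* 1-x^[ 5 ]· q :* 1-x^[ 6 ]· q
               :* (T - (con 1ℚ :+ t :* (T :* (T :* (T :* con 1ℚ)))))))
      refl (𝑻 ∷ 𝑿 ∷ 𝒕 ∷ q ∷ []))
    (+-vanish (𝓛.trans (𝓛.*-congˡ (K-vanishes q)) (𝓛.zeroʳ _))
      (vanish (F.1-x^[ 1 ]· q *ₗ F.1-x^[ 2 ]· q *ₗ F.1-x^[ 3 ]· q
                 *ₗ F.1-x^[ 4 ]· q *ₗ F.1-x^[ 5 ]· q *ₗ F.1-x^[ 6 ]· q) T-equation))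

  core-identity : ∀ q → F.Nᶜ 𝑾 (𝑿 *ₗ q) *ₗ (F.Dᶜ 𝑾 (𝑿 *ₗ (𝑿 *ₗ q)) *ₗ F.Dᵖ q)
    ≈ₗ F.Dᶜ 𝑾 (𝑿 *ₗ q) *ₗ (F.Dᶜ 𝑾 (𝑿 *ₗ (𝑿 *ₗ q)) *ₗ F.Dᵖ q)
       +ₗ (𝒕 *ₗ 𝒖) *ₗ (F.Nᶜ 𝑾 (𝑿 *ₗ (𝑿 *ₗ q)) *ₗ (F.Nᶜ 𝑾 (𝑿 *ₗ q) *ₗ F.Nᵖ 𝑻 q))
  core-identity q = drop-vanishing (solve 6 (λ X T W t u q →
      let open ClosedForms (Expr-rawRing 6) X in
      Nᶜ W (X :* q) :* (Dᶜ W (X :* (X :* q)) :* Dᵖ q)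
      := Dᶜ W (X :* q) :* (Dᶜ W (X :* (X :* q)) :* Dᵖ q) :+ (t :* u) :* (Nᶜ W (X :* (X :* q)) :* (Nᶜ W (X :* q) :* Nᵖ T q))
         :+ H W (X :* (X :* q)) :* H W (X :* (X :* (X :* q))) :* 1-x^[ 1 ]· q :* 1-x^[ 2 ]· q :* 1-x^[ 3 ]· q :* 1-x^[ 4 ]· q
            :* (W - (con 1ℚ :+ t :* u :* (W :* (W :* con 1ℚ)) :* T)))
      refl (𝑿 ∷ 𝑻 ∷ 𝑾 ∷ 𝒕 ∷ 𝒖 ∷ q ∷ []))
    (vanish (F.H 𝑾 (𝑿 *ₗ (𝑿 *ₗ q)) *ₗ F.H 𝑾 (𝑿 *ₗ (𝑿 *ₗ (𝑿 *ₗ q))) *ₗ F.1-x^[ 1 ]· q *ₗ F.1-x^[ 2 ]· q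
              *ₗ F.1-x^[ 3 ]· q *ₗ F.1-x^[ 4 ]· q) W-equation)

  plain-base : F.Dᵖ 𝟏 ≈ₗ F.Nᵖ 𝑻 𝟏
  plain-base = 𝓛.sym (drop-vanishing (solve 2 (λ T X →
      let open ClosedForms (Expr-rawRing 2) X in
      Nᵖ T (con 1ℚ)
      := Dᵖ (con 1ℚ) :+ 1-x^[ 1 ]· con 1ℚ :* 1-x^[ 2 ]· con 1ℚ
                          :* (T :* (con 1ℚ :+ X :* X) - (con 1ℚ :+ X :+ X :* X)))
      refl (𝑻 ∷ 𝑿 ∷ []))
    (vanish (F.1-x^[ 1 ]· 𝟏 *ₗ F.1-x^[ 2 ]· 𝟏) T-quadratic))

  core-base : F.Dᶜ 𝑾 𝟏 ≈ₗ F.Nᶜ 𝑾 𝟏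
  core-base = solve 2 (λ X W →
      let open ClosedForms (Expr-rawRing 2) X in Dᶜ W (con 1ℚ) := Nᶜ W (con 1ℚ))
    refl (𝑿 ∷ 𝑾 ∷ [])

  plain-unit : ∀ q → IsUnit (⟦ F.Dᵖ (𝑿 *ₗ (𝑿 *ₗ q)) ⟧ ⊗ ⟦ F.Dᵖ q ⟧)
  plain-unit q = product-unit (F.Dᵖ (𝑿 *ₗ (𝑿 *ₗ q))) (F.Dᵖ q)
    (≋[]-trans {1} {⟦ F.Dᵖ (𝑿 *ₗ (𝑿 *ₗ q)) *ₗ F.Dᵖ q ⟧}
      (*-congₜ {F.Dᵖ (𝑿 *ₗ (𝑿 *ₗ q))} {F₀.Dᵖ (𝑿 *ₗ (𝑿 *ₗ q))} {F.Dᵖ q} {F₀.Dᵖ q}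
        (≈ₜ-Congruence.Dᵖ-cong {𝑿} {𝟎} {𝑿 *ₗ (𝑿 *ₗ q)} {𝑿 *ₗ (𝑿 *ₗ q)} X≈ₜ0
          (≋[]-refl {1} {⟦ 𝑿 *ₗ (𝑿 *ₗ q) ⟧}))
        (≈ₜ-Congruence.Dᵖ-cong {𝑿} {𝟎} {q} {q} X≈ₜ0 (≋[]-refl {1} {⟦ q ⟧})))
      (≋⇒≋[] (lower (solve 2 (λ X q → let open ClosedForms (Expr-rawRing 2) (con 0ℚ) in
        Dᵖ (X :* (X :* q)) :* Dᵖ q := con 1ℚ) refl (𝑿 ∷ q ∷ [])))))
    refl

  core-unit : ∀ q → IsUnit (⟦ F.Dᶜ 𝑾 (𝑿 *ₗ (𝑿 *ₗ q)) ⟧ ⊗ ⟦ F.Dᵖ q ⟧)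
  core-unit q = product-unit (F.Dᶜ 𝑾 (𝑿 *ₗ (𝑿 *ₗ q))) (F.Dᵖ q)
    (≋[]-trans {1} {⟦ F.Dᶜ 𝑾 (𝑿 *ₗ (𝑿 *ₗ q)) *ₗ F.Dᵖ q ⟧}
      (*-congₜ {F.Dᶜ 𝑾 (𝑿 *ₗ (𝑿 *ₗ q))} {F₀.Dᶜ 𝟏 (𝑿 *ₗ (𝑿 *ₗ q))} {F.Dᵖ q} {F₀.Dᵖ q}
        (≈ₜ-Congruence.Dᶜ-cong {𝑿} {𝟎} {𝑾} {𝟏} {𝑿 *ₗ (𝑿 *ₗ q)} {𝑿 *ₗ (𝑿 *ₗ q)} X≈ₜ0 W≈ₜ1
          (≋[]-refl {1} {⟦ 𝑿 *ₗ (𝑿 *ₗ q) ⟧}))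
        (≈ₜ-Congruence.Dᵖ-cong {𝑿} {𝟎} {q} {q} X≈ₜ0 (≋[]-refl {1} {⟦ q ⟧})))
      (≋⇒≋[] (lower (solve 2 (λ X q → let open ClosedForms (Expr-rawRing 2) (con 0ℚ) in
        Dᶜ (con 1ℚ) (X :* (X :* q)) :* Dᵖ q := con (ℚ.- 1ℚ)) refl (𝑿 ∷ q ∷ [])))))
    refl

  power : ℕ → FPSₗ
  power zero = 𝟏
  power (suc i) = 𝑿 *ₗ power i

  power≈X^ : ∀ i → power i ≈ₗ ser (X ^S i)
  power≈X^ zero = lift 𝓕.refl
  power≈X^ (suc i) = 𝓛.*-congˡ {𝑿} (power≈X^ i)

  module ≈ₗ-Congruence = FormsCongruence rawRingₗ _≈ₗ_ 𝓛.refl 𝓛.+-cong 𝓛.*-cong 𝓛.-‿cong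

  dᵖ nᵖ dᶜ nᶜ : ℕ → FPS
  dᵖ i = ⟦ F.Dᵖ (power i) ⟧
  nᵖ i = ⟦ F.Nᵖ 𝑻 (power i) ⟧
  dᶜ i = ⟦ F.Dᶜ 𝑾 (power i) ⟧
  nᶜ i = ⟦ F.Nᶜ 𝑾 (power i) ⟧

  plain-solution : ∀ i → limit (plain , predℤ i) ⊗ dᵖ i ≈ nᵖ i
  plain-solution = recurrence-uniqueness tS (λ _ → refl) Sᵢ Sᵢ nᵖ dᵖ nᵖ dᵖ
    (limit-base plain) (lower plain-base) (limit-recurrence plain) (λ n agree → agree)
    (λ i → ⟦⟧-recurrence 𝒕 (F.Nᵖ 𝑻 (power (suc i))) (F.Nᵖ 𝑻 (power (suc (suc i)))) (F.Nᵖ 𝑻 (power i))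
             (F.Dᵖ (power (suc i))) (F.Dᵖ (power (suc (suc i)))) (F.Dᵖ (power i))
             (plain-identity (power i)))
    (λ i → plain-unit (power i))
    where
    Sᵢ = λ i → limit (plain , predℤ i)

  core-solution : ∀ i → limit (core , predℤ i) ⊗ dᶜ i ≈ nᶜ i
  core-solution = recurrence-uniqueness (tS ⊗ uS) (tS-⊗-zero uS)
    (λ i → limit (core , predℤ i)) (λ i → limit (plain , predℤ i)) nᶜ dᶜ nᵖ dᵖ
    (limit-base core) (lower core-base) (limit-recurrence core) (λ n _ i → ≋⇒≋[] (plain-solution i))
    (λ i → ⟦⟧-recurrence (𝒕 *ₗ 𝒖) (F.Nᶜ 𝑾 (power (suc i))) (F.Nᶜ 𝑾 (power (suc (suc i))))
             (F.Nᵖ 𝑻 (power i)) (F.Dᶜ 𝑾 (power (suc i))) (F.Dᶜ 𝑾 (power (suc (suc i))))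
             (F.Dᵖ (power i)) (core-identity (power i)))
    (λ i → core-unit (power i))

  denominator : ∀ i → Hj X W (predℤ i ℤ.- + 1) ⊗ (𝟙 ⊖ X ^ℤ (predℤ i ℤ.+ + 3)) ≈ dᶜ i
  denominator i = 𝓕.trans
    (𝓕.reflexive (≡.cong₂ (λ a b → ((X ⊖ X ^S a) ⊗ W ⊖ (𝟙 ⊕ X) ⊗ (𝟙 ⊖ X ^S a)) ⊗ (𝟙 ⊖ X ^S b))
      (exponent-H i) (exponent-denominator i)))
    (lower (𝓛.sym (≈ₗ-Congruence.Dᶜ-cong {𝑿} {𝑿} {𝑾} {𝑾} {power i} {ser (X ^S i)}
      𝓛.refl 𝓛.refl (power≈X^ i))))
    where
    exponent-H : ∀ i → ℤ.∣ predℤ i ℤ.- + 1 ℤ.+ + 2 ∣ ≡ i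
    exponent-H zero = refl
    exponent-H (suc i) = ≡.trans (≡.cong ℤ.∣_∣ (ℤ.+-assoc (+ i) -[1+ 0 ] (+ 2))) (ℕ.+-comm i 1)
    exponent-denominator : ∀ i → ℤ.∣ predℤ i ℤ.+ + 3 ∣ ≡ suc (suc i)
    exponent-denominator zero = refl
    exponent-denominator (suc i) = ℕ.+-comm i 3

  numerator : ∀ i → W ⊗ Hj X W (predℤ i) ⊗ (𝟙 ⊖ X ^ℤ (predℤ i ℤ.+ + 2)) ≈ nᶜ i
  numerator i = 𝓕.trans
    (𝓕.reflexive (≡.cong (λ a → W ⊗ ((X ⊖ X ^S a) ⊗ W ⊖ (𝟙 ⊕ X) ⊗ (𝟙 ⊖ X ^S a)) ⊗ (𝟙 ⊖ X ^S a))
      (exponent-numerator i)))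
    (lower (𝓛.sym (≈ₗ-Congruence.Nᶜ-cong {𝑿} {𝑿} {𝑾} {𝑾} {power i} {ser (X ^S i)}
      𝓛.refl 𝓛.refl (power≈X^ i))))
    where
    exponent-numerator : ∀ i → ℤ.∣ predℤ i ℤ.+ + 2 ∣ ≡ suc i
    exponent-numerator zero = refl
    exponent-numerator (suc i) = ℕ.+-comm i 2

  Tgf-identity : ∀ i → Tgf (predℤ i) ⊗ Hj X W (predℤ i ℤ.- + 1) ⊗ (𝟙 ⊖ X ^ℤ (predℤ i ℤ.+ + 3))
    ≈ W ⊗ Hj X W (predℤ i) ⊗ (𝟙 ⊖ X ^ℤ (predℤ i ℤ.+ + 2))
  Tgf-identity i = 𝓕.trans (𝓕.*-assoc (Tgf j) H E)
    (𝓕.trans (𝓕.*-cong {Tgf j} {limit (core , j)} {H ⊗ E} {dᶜ i} (Tgf≈limit j) (denominator i))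
    (𝓕.trans (core-solution i) (𝓕.sym (numerator i))))
    where
    j = predℤ i
    H = Hj X W (j ℤ.- + 1)
    E = 𝟙 ⊖ X ^ℤ (j ℤ.+ + 3)

open import Data.Integer using (ℤ; +_; -[1+_]; _≤_; _+_; _-_)
import Data.Integer as ℤ
open import Data.Nat using (suc)
open import Data.Rational using (0ℚ)
open import Relation.Binary.PropositionalEquality using (_≡_)

theorem10 : (T B X Tu : FPS)
    → T ≈ 𝟙 ⊕ tS ⊗ T ^S 3
    → B ≈ tS ⊗ T ^S 2
    → X ≈ B ⊗ (𝟙 ⊕ X ⊕ X ^S 2)
    → (∀ k → X 0 k ≡ 0ℚ)
    → Tu ≈ 𝟙 ⊕ tS ⊗ uS ⊗ Tu ^S 2 ⊗ T
    → (j : ℤ) → -[1+ 0 ] ≤ j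
    → Tgf j ⊗ Hj X Tu (j - + 1) ⊗ (𝟙 ⊖ X ^ℤ (j + + 3))
    ≈ Tu ⊗ Hj X Tu j ⊗ (𝟙 ⊖ X ^ℤ (j + + 2))
theorem10 T B X Tu hT hB hX hX0 hTu -[1+ 0 ] _ = Solution.Tgf-identity T B X Tu hT hB hX hX0 hTu 0
theorem10 T B X Tu hT hB hX hX0 hTu (+ n) _ = Solution.Tgf-identity T B X Tu hT hB hX hX0 hTu (suc n)
theorem10 T B X Tu hT hB hX hX0 hTu -[1+ suc n ] (ℤ.-≤- ())
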